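{- For every $n,s \in \mathbb{N}$ and every $\bm{k}=(k_1,\ldots,k_s) \in \mathbb{N}^s$, at least one of the $\bm{k}$-extremal graphs of order $n$ is complete multipartite. That is, there is a complete multipartite graph $G$ on $n$ vertices with $F(G;\bm{k}) = F(n;\bm{k})$.
   Context: For $s\in\mathbb{N}$ write $[s]=\{1,\dots,s\}$. An $s$-edge-colouring of a graph $G=(V,E)$ is any function $\sigma:E\to[s]$ (not necessarily proper). Given $\bm{k}=(k_1,\dots,k_s)\in\mathbb{N}^s$, a colouring $\sigma$ is $\bm{k}$-valid if for every $c\in[s]$ the subgraph formed by the edges of colour $c$, $\sigma^{ -1}(c)$, contains no copy of the complete graph $K_{k_c}$. $F(G;\bm{k})$ denotes the number of $\bm{k}$-valid $s$-edge-colourings of $G$, and $F(n;\bm{k})$ denotes the maximum of $F(G;\bm{k})$ over all graphs $G$ on $n$ vertices. A graph $G$ on $n$ vertices is $\bm{k}$-extremal if $F(G;\bm{k})=F(n;\bm{k})$. -}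

module Defs where

open import Data.Bool using (Bool; true; false; _∧_; _∨_)
open import Data.Nat using (ℕ; zero; suc; _<ᵇ_; _≡ᵇ_)
open import Data.Fin using (Fin; toℕ)
open import Data.List using (List; []; _∷_; map; concatMap; filterᵇ; length; allFin; zip)
open import Data.Bool.ListAction using (any; all)
open import Data.Vec using (Vec; []; _∷_; toList; lookup)
open import Data.Product using (_×_; _,_; proj₁; proj₂; Σ)
open import Relation.Binary.PropositionalEquality using (_≡_; _≢_)
open import Function.Bundles using (_⇔_)

record Graph (n : ℕ) : Set where
  field
    adj    : Fin n → Fin n → Bool
    sym    : ∀ i j → adj i j ≡ adj j i
    irrefl : ∀ i → adj i i ≡ false
open Graph public

_==_ : {n : ℕ} → Fin n → Fin n → Bool
i == j = toℕ i ≡ᵇ toℕ j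

allVecs : {A : Set} → List A → (m : ℕ) → List (Vec A m)
allVecs xs zero    = [] ∷ []
allVecs xs (suc m) = concatMap (λ x → map (x ∷_) (allVecs xs m)) xs

pairs : (n : ℕ) → List (Fin n × Fin n)
pairs n = concatMap (λ i → map (i ,_) (filterᵇ (λ j → toℕ i <ᵇ toℕ j) (allFin n))) (allFin n)

edges : {n : ℕ} → Graph n → List (Fin n × Fin n)
edges G = filterᵇ (λ e → adj G (proj₁ e) (proj₂ e)) (pairs _)

-- An s-edge-colouring of G: a colour in Fin s for each edge of E(G)
-- (the m-th entry is the colour of the m-th edge of 'edges G').
Colouring : {n : ℕ} → ℕ → Graph n → Set
Colouring s G = Vec (Fin s) (length (edges G))

allColourings : {n : ℕ} (s : ℕ) (G : Graph n) → List (Colouring s G)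
allColourings s G = allVecs (allFin s) (length (edges G))

colouredEdges : {n s : ℕ} (G : Graph n) → Colouring s G → List ((Fin n × Fin n) × Fin s)
colouredEdges G σ = zip (edges G) (toList σ)

hasColour : {n s : ℕ} (G : Graph n) → Colouring s G → Fin s → Fin n → Fin n → Bool
hasColour G σ c i j =
  any (λ e → (proj₁ (proj₁ e) == i) ∧ (proj₂ (proj₁ e) == j) ∧ (proj₂ e == c)) (colouredEdges G σ)

-- Vertex subsets of Fin n, as characteristic vectors.
size : {n : ℕ} → Vec Bool n → ℕ
size [] = zero
size (true ∷ S) = suc (size S)
size (false ∷ S) = size S

containsClique : {n s : ℕ} (G : Graph n) → Colouring s G → Fin s → ℕ → Bool
containsClique {n} G σ c k =
  any (λ S → (size S ≡ᵇ k) ∧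
             all (λ p → (lookup S (proj₁ p) ∧ lookup S (proj₂ p)) ⇒ᵇ hasColour G σ c (proj₁ p) (proj₂ p))
                 (pairs n))
      (allVecs (true ∷ false ∷ []) n)
  where
  _⇒ᵇ_ : Bool → Bool → Bool
  true  ⇒ᵇ b = b
  false ⇒ᵇ b = true

valid : {n s : ℕ} (G : Graph n) (k : Vec ℕ s) → Colouring s G → Bool
valid {s = s} G k σ = all (λ c → notb (containsClique G σ c (lookup k c))) (allFin s)
  where
  notb : Bool → Bool
  notb true = false
  notb false = true

F : {n s : ℕ} → Graph n → Vec ℕ s → ℕ
F {s = s} G k = length (filterᵇ (valid G k) (allColourings s G))

IsCompleteMultipartite : {n : ℕ} → Graph n → Set
IsCompleteMultipartite {n} G =
  Σ ℕ λ r → Σ (Fin n → Fin r) λ part → ∀ i j → (adj G i j ≡ true ⇔ part i ≢ part j)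

-- Zykov symmetrisation.  For non-adjacent vertices u ≠ w, the k-valid colourings of G
-- are obtained by colouring the edges avoiding u and w (a colour relation h) and then,
-- independently, the edges at u and the edges at w, since no monochromatic clique
-- contains both u and w.  So F(G) = Σ_h a(h) b(h), with a(h), b(h) the numbers of valid
-- extensions of h at u and at w.  Making w a twin of u turns this into Σ_h a(h)², making
-- u a twin of w into Σ_h b(h)² (the transposition of u and w relabels one star as the
-- other), so 2ab ≤ a² + b² shows that twinning preserves extremality.  Starting from an
-- extremal graph (there are finitely many graphs) and letting each vertex in turn absorb
-- its non-neighbours as twins gives an extremal graph in which non-adjacent vertices have
-- equal neighbourhoods, that is, a complete multipartite graph.

module Submission where

open import Algebra.Bundles using (CommutativeMonoid)
open import Algebra.Properties.CommutativeSemigroup using (interchange)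
open import Data.Bool using (Bool; true; false; T; T?; not; _∧_; _∨_; if_then_else_)
open import Data.Bool.ListAction using (any; all)
open import Data.Bool.Properties using (T-≡; T-not-≡; T-∧; T-∨; ∧-assoc; ∧-identityʳ; ∧-zeroʳ; ∨-assoc; ∨-comm; ∨-identityʳ; ∨-commutativeMonoid)
open import Data.Empty using (⊥; ⊥-elim)
open import Data.Fin using (Fin; toℕ; _≟_; fromℕ<)
import Data.Fin as Fin
open import Data.Fin.Permutation using (Permutation′; _⟨$⟩ʳ_; _⟨$⟩ˡ_; inverseʳ; inverseˡ; flip; transpose)
open import Data.Fin.Properties using (toℕ-injective; toℕ-fromℕ<; toℕ<n)
open import Data.List using (List; []; _∷_; map; concatMap; filterᵇ; length; zip; allFin; _++_)
open import Data.List.Extrema.Nat using (argmax; v≤f[argmax]⁺)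
open import Data.List.Membership.Propositional using (_∈_; _∉_; find; lose)
open import Data.List.Membership.Propositional.Properties
  using (∈-allFin; ∈-map⁺; ∈-map⁻; ∈-concatMap⁺; ∈-concatMap⁻; ∈-filter⁺; ∈-filter⁻)
open import Data.List.Membership.Propositional.Properties.WithK using (unique∧set⇒bag)
open import Data.List.Properties using (map-cong; map-++; map-∘; ++-assoc)
open import Data.List.Relation.Binary.BagAndSetEquality using (∼bag⇒↭)
open import Data.List.Relation.Binary.Permutation.Propositional as ↭
  using (_↭_; ↭-refl; ↭-sym; ↭-trans; ↭-reflexive; module PermutationReasoning)
import Data.List.Relation.Binary.Permutation.Propositional.Properties as Perm
import Data.List.Relation.Unary.All as All
open import Data.List.Relation.Unary.All.Properties using (all⁺; all⁻)
import Data.List.Relation.Unary.All.Properties as All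
import Data.List.Relation.Unary.AllPairs as AllPairs
import Data.List.Relation.Unary.AllPairs.Properties as AllPairs
open import Data.List.Relation.Unary.Any using (here; there)
open import Data.List.Relation.Unary.Any.Properties using (any⁺; any⁻)
open import Data.List.Relation.Unary.Unique.Propositional using (Unique)
import Data.List.Relation.Unary.Unique.Propositional.Properties as Unique
open import Data.Maybe using (Maybe; just; nothing; fromMaybe)
open import Data.Maybe.Properties using (just-injective)
import Data.Maybe as Maybe
open import Data.Nat using (ℕ; zero; suc; _+_; _*_; _≤_; _<_; _≡ᵇ_; _<ᵇ_; z≤n; s≤s⁻¹)
open import Data.Nat.ListAction using (sum)
open import Data.Nat.ListAction.Properties using (sum-++)
open import Data.Nat.Properties
  using ( ≡ᵇ⇒≡; ≡⇒≡ᵇ; <ᵇ⇒<; <⇒<ᵇ; <-cmp; <-irrefl; <-asym; <⇒≤; ≤-refl; ≤-reflexive; ≤-trans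
        ; m≤n⇒m<n∨m≡n; +-identityʳ; +-mono-≤; +-monoˡ-≤; +-monoʳ-≤; +-cancelʳ-≤
        ; *-comm; *-zeroʳ; *-distribˡ-+; +-commutativeSemigroup; +-0-commutativeMonoid; module ≤-Reasoning)
open import Algebra.Properties.CommutativeMonoid.Sum +-0-commutativeMonoid using (sum-permute; sum-cong-≗)
  renaming (sum to ∑ᶠ)
open import Data.Nat.Tactic.RingSolver using (solve-∀)
open import Data.Product using (Σ; ∃; _×_; _,_; proj₁; proj₂)
open import Data.Sum using (_⊎_; inj₁; inj₂; [_,_]′)
open import Data.Vec using (Vec; []; _∷_; lookup; tabulate; toList)
open import Data.Vec.Properties using (lookup∘tabulate)
open import Function using (_∘_)
open import Function.Bundles using (_⇔_; mk⇔; Equivalence)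
open import Relation.Binary using (tri<; tri≈; tri>)
open import Relation.Binary.PropositionalEquality
open import Relation.Nullary using (¬_; yes; no)
open import Relation.Nullary.Decidable using (dec-true; dec-false)

open import Defs hiding (sym)

variable
  A B : Set
  m n s : ℕ
  x : A
  xs : List A

==⇒≡ : {i j : Fin n} → T (i == j) → i ≡ j
==⇒≡ {i = i} {j} p = toℕ-injective (≡ᵇ⇒≡ (toℕ i) (toℕ j) p)

≡⇒== : {i j : Fin n} → i ≡ j → T (i == j)
≡⇒== {i = i} refl = ≡⇒≡ᵇ (toℕ i) (toℕ i) refl

==-refl : (i : Fin n) → T (i == i)
==-refl i = ≡⇒≡ᵇ (toℕ i) (toℕ i) refl

T-ext : {a b : Bool} → (T a → T b) → (T b → T a) → a ≡ b
T-ext {false} {false} _ _ = refl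
T-ext {false} {true}  _ g = ⊥-elim (g _)
T-ext {true}  {false} f _ = ⊥-elim (f _)
T-ext {true}  {true}  _ _ = refl

T-⇒ᵇ : {a b : Bool} → T (not a ∨ b) → T a → T b
T-⇒ᵇ {true} t _ = t

⇒ᵇ-T : {a b : Bool} → (T a → T b) → T (not a ∨ b)
⇒ᵇ-T {true}  f = f _
⇒ᵇ-T {false} f = _

T-not⁻ : {a : Bool} → T (not a) → ¬ T a
T-not⁻ {false} _ ()

T-not⁺ : {a : Bool} → ¬ T a → T (not a)
T-not⁺ {true}  ¬a = ¬a _
T-not⁺ {false} _  = _

true≢false : true ≢ false
true≢false ()

∧-T : {a b : Bool} → T (a ∧ b) → T a × T b
∧-T {a} = Equivalence.to (T-∧ {a})

indicator : Bool → ℕ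
indicator true  = 1
indicator false = 0

indicator-∧ : ∀ a b → indicator (a ∧ b) ≡ indicator a * indicator b
indicator-∧ true  b = sym (+-identityʳ (indicator b))
indicator-∧ false b = refl

∑ : List A → (A → ℕ) → ℕ
∑ xs f = sum (map f xs)

∑-cong : (xs : List A) {f g : A → ℕ} → (∀ x → f x ≡ g x) → ∑ xs f ≡ ∑ xs g
∑-cong xs f≗g = cong sum (map-cong f≗g xs)

∑-mono : (xs : List A) {f g : A → ℕ} → (∀ x → f x ≤ g x) → ∑ xs f ≤ ∑ xs g
∑-mono []       f≤g = ≤-refl
∑-mono (x ∷ xs) f≤g = +-mono-≤ (f≤g x) (∑-mono xs f≤g)

∑-+ : (xs : List A) (f g : A → ℕ) → ∑ xs (λ x → f x + g x) ≡ ∑ xs f + ∑ xs g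
∑-+ []       f g = refl
∑-+ (x ∷ xs) f g = trans (cong (f x + g x +_) (∑-+ xs f g))
                         (interchange +-commutativeSemigroup (f x) (g x) (∑ xs f) (∑ xs g))

∑-*ˡ : (xs : List A) (a : ℕ) (f : A → ℕ) → ∑ xs (λ x → a * f x) ≡ a * ∑ xs f
∑-*ˡ []       a f = sym (*-zeroʳ a)
∑-*ˡ (x ∷ xs) a f = trans (cong (a * f x +_) (∑-*ˡ xs a f)) (sym (*-distribˡ-+ a (f x) _))

∑-zero : (xs : List A) → ∑ xs (λ _ → 0) ≡ 0
∑-zero []       = refl
∑-zero (_ ∷ xs) = ∑-zero xs

∑-swap : (xs : List A) (ys : List B) (f : A → B → ℕ) →
         ∑ xs (λ x → ∑ ys (f x)) ≡ ∑ ys (λ y → ∑ xs (λ x → f x y))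
∑-swap []       ys f = sym (∑-zero ys)
∑-swap (x ∷ xs) ys f = trans (cong (∑ ys (f x) +_) (∑-swap xs ys f))
                             (sym (∑-+ ys (f x) (λ y → ∑ xs (λ x′ → f x′ y))))

∑-++ : (xs ys : List A) (f : A → ℕ) → ∑ (xs ++ ys) f ≡ ∑ xs f + ∑ ys f
∑-++ xs ys f = trans (cong sum (map-++ f xs ys)) (sum-++ (map f xs) (map f ys))

∑-map : (xs : List A) (h : A → B) (f : B → ℕ) → ∑ (map h xs) f ≡ ∑ xs (λ x → f (h x))
∑-map xs h f = cong sum (sym (map-∘ xs))

∑-concatMap : (xs : List A) (h : A → List B) (f : B → ℕ) →
              ∑ (concatMap h xs) f ≡ ∑ xs (λ x → ∑ (h x) f)
∑-concatMap []       h f = refl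
∑-concatMap (x ∷ xs) h f = trans (∑-++ (h x) (concatMap h xs) f) (cong (∑ (h x) f +_) (∑-concatMap xs h f))

length-filterᵇ : (p : A → Bool) (xs : List A) → length (filterᵇ p xs) ≡ ∑ xs (λ x → indicator (p x))
length-filterᵇ p []       = refl
length-filterᵇ p (x ∷ xs) with p x
... | true  = cong (1 +_) (length-filterᵇ p xs)
... | false = length-filterᵇ p xs

↭-unique : {xs ys : List A} → Unique xs → Unique ys →
           (∀ {z} → z ∈ xs → z ∈ ys) → (∀ {z} → z ∈ ys → z ∈ xs) → xs ↭ ys
↭-unique xs! ys! to from = ∼bag⇒↭ (unique∧set⇒bag xs! ys! (mk⇔ to from))

filterᵇ-split : (p q : A → Bool) (xs : List A) →
  filterᵇ p xs ↭ filterᵇ (λ x → p x ∧ q x) xs ++ filterᵇ (λ x → p x ∧ not (q x)) xs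
filterᵇ-split p q []       = ↭-refl
filterᵇ-split p q (x ∷ xs) with p x | q x
... | true  | true  = ↭.prep x (filterᵇ-split p q xs)
... | true  | false = ↭-trans (↭.prep x (filterᵇ-split p q xs)) (↭-sym (Perm.shift x _ _))
... | false | _     = filterᵇ-split p q xs

∈-filterᵇ⁺ : (p : A → Bool) → x ∈ xs → T (p x) → x ∈ filterᵇ p xs
∈-filterᵇ⁺ p = ∈-filter⁺ (T? ∘ p)

∈-filterᵇ⁻ : (p : A → Bool) → x ∈ filterᵇ p xs → x ∈ xs × T (p x)
∈-filterᵇ⁻ p = ∈-filter⁻ (T? ∘ p)

filterᵇ-cong : {p q : A → Bool} → (∀ x → p x ≡ q x) → (xs : List A) → filterᵇ p xs ≡ filterᵇ q xs
filterᵇ-cong eq []       = refl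
filterᵇ-cong {p = p} {q} eq (x ∷ xs) with p x | q x | eq x
... | true  | true  | _ = cong (x ∷_) (filterᵇ-cong eq xs)
... | false | false | _ = filterᵇ-cong eq xs

2*m*n≤m*m+n*n : ∀ m n → 2 * (m * n) ≤ m * m + n * n
2*m*n≤m*m+n*n zero    n       = z≤n
2*m*n≤m*m+n*n (suc m) zero    rewrite *-zeroʳ m = z≤n
2*m*n≤m*m+n*n (suc m) (suc n) = subst₂ _≤_ (lhs m n) (rhs m n) (+-monoˡ-≤ (2 * m + 2 * n + 2) (2*m*n≤m*m+n*n m n))
  where
  lhs : ∀ m n → 2 * (m * n) + (2 * m + 2 * n + 2) ≡ 2 * (suc m * suc n)
  lhs = solve-∀
  rhs : ∀ m n → (m * m + n * n) + (2 * m + 2 * n + 2) ≡ suc m * suc m + suc n * suc n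
  rhs = solve-∀

Edge : ℕ → Set
Edge n = Fin n × Fin n

row : (i : Fin n) → List (Edge n)
row {n} i = map (i ,_) (filterᵇ (λ j → toℕ i <ᵇ toℕ j) (allFin n))

∈-pairs⁺ : {i j : Fin n} → toℕ i < toℕ j → (i , j) ∈ pairs n
∈-pairs⁺ {i = i} {j} i<j =
  ∈-concatMap⁺ row (lose (∈-allFin i) (∈-map⁺ (i ,_) (∈-filterᵇ⁺ (λ j → toℕ i <ᵇ toℕ j) (∈-allFin j) (<⇒<ᵇ i<j))))

∈-pairs⁻ : {i j : Fin n} → (i , j) ∈ pairs n → toℕ i < toℕ j
∈-pairs⁻ {n} p∈ with find (∈-concatMap⁻ row {allFin n} p∈)
... | i , _ , p∈row with ∈-map⁻ (i ,_) p∈row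
... | j , j∈ , refl = <ᵇ⇒< _ _ (proj₂ (∈-filterᵇ⁻ {xs = allFin n} (λ j → toℕ i <ᵇ toℕ j) j∈))

pairs-unique : Unique (pairs n)
pairs-unique {n} = Unique.concat⁺
  (All.map⁺ (All.universal row-unique (allFin n)))
  (AllPairs.map⁺ (AllPairs.map row-disjoint (Unique.allFin⁺ n)))
  where
  row-unique : (i : Fin n) → Unique (row i)
  row-unique i = Unique.map⁺ (cong proj₂) (Unique.filter⁺ _ (Unique.allFin⁺ n))
  row-source : {i : Fin n} {e : Edge n} → e ∈ row i → proj₁ e ≡ i
  row-source {i = i} e∈ with ∈-map⁻ (i ,_) e∈
  ... | _ , _ , refl = refl
  row-disjoint : {i i′ : Fin n} → i ≢ i′ → ∀ {e} → ¬ (e ∈ row i × e ∈ row i′)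
  row-disjoint i≢i′ (e∈ , e∈′) = i≢i′ (trans (sym (row-source e∈)) (row-source e∈′))

-- The edge {a , x}, oriented as in `pairs`.
key : Fin n → Fin n → Edge n
key a x = if toℕ x <ᵇ toℕ a then (x , a) else (a , x)

_≈ₑ_ : Edge n → Edge n → Set
(p , q) ≈ₑ (a , b) = (p ≡ a × q ≡ b) ⊎ (p ≡ b × q ≡ a)

key-cases : (a x : Fin n) → (key a x ≡ (x , a) × toℕ x < toℕ a) ⊎ (key a x ≡ (a , x) × ¬ toℕ x < toℕ a)
key-cases a x with toℕ x <ᵇ toℕ a in eq
... | true  = inj₁ (refl , <ᵇ⇒< _ _ (subst T (sym eq) _))
... | false = inj₂ (refl , λ x<a → subst T eq (<⇒<ᵇ x<a))

key-≈ₑ : (a x : Fin n) → key a x ≈ₑ (a , x)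
key-≈ₑ a x with key-cases a x
... | inj₁ (eq , _) rewrite eq = inj₂ (refl , refl)
... | inj₂ (eq , _) rewrite eq = inj₁ (refl , refl)

key-ordered : {a x : Fin n} → a ≢ x → toℕ (proj₁ (key a x)) < toℕ (proj₂ (key a x))
key-ordered {a = a} {x} a≢x with key-cases a x
... | inj₁ (eq , x<a) rewrite eq = x<a
... | inj₂ (eq , x≮a) rewrite eq with <-cmp (toℕ a) (toℕ x)
...   | tri< a<x _ _ = a<x
...   | tri≈ _ a≡x _ = ⊥-elim (a≢x (toℕ-injective a≡x))
...   | tri> _ _ x<a = ⊥-elim (x≮a x<a)

key-unique : {a x i j : Fin n} → toℕ i < toℕ j → (i , j) ≈ₑ (a , x) → key a x ≡ (i , j)
key-unique {a = a} {x} i<j (inj₁ (refl , refl)) with key-cases a x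
... | inj₁ (_ , j<i) = ⊥-elim (<-asym i<j j<i)
... | inj₂ (eq , _)  = eq
key-unique {a = a} {x} i<j (inj₂ (refl , refl)) with key-cases a x
... | inj₁ (eq , _)  = eq
... | inj₂ (_ , j≮i) = ⊥-elim (j≮i i<j)

key-injective : {a x y : Fin n} → key a x ≡ key a y → x ≡ y
key-injective {a = a} {x} {y} eq with key-≈ₑ a x | key-≈ₑ a y
... | inj₁ (_ , p)  | inj₁ (_ , q)  = trans (sym p) (trans (cong proj₂ eq) q)
... | inj₁ (p , p′) | inj₂ (q , q′) = trans (trans (sym p′) (trans (cong proj₂ eq) q′)) (trans (sym p) (trans (cong proj₁ eq) q))
... | inj₂ (p , p′) | inj₁ (q , q′) = trans (trans (sym p) (trans (cong proj₁ eq) q)) (trans (sym p′) (trans (cong proj₂ eq) q′))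
... | inj₂ (p , _)  | inj₂ (q , _)  = trans (sym p) (trans (cong proj₁ eq) q)

≈ₑ-swap : {p q a b : Fin n} → (p , q) ≈ₑ (a , b) → (q , p) ≈ₑ (a , b)
≈ₑ-swap (inj₁ (p≡a , q≡b)) = inj₂ (q≡b , p≡a)
≈ₑ-swap (inj₂ (p≡b , q≡a)) = inj₁ (q≡a , p≡b)

≈ₑ-map : (f : Fin n → Fin n) {p q a b p′ q′ a′ b′ : Fin n} →
  f p ≡ p′ → f q ≡ q′ → f a ≡ a′ → f b ≡ b′ → (p , q) ≈ₑ (a , b) → (p′ , q′) ≈ₑ (a′ , b′)
≈ₑ-map f fp fq fa fb (inj₁ (refl , refl)) = inj₁ (trans (sym fp) fa , trans (sym fq) fb)
≈ₑ-map f fp fq fa fb (inj₂ (refl , refl)) = inj₂ (trans (sym fp) fb , trans (sym fq) fa)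

key-either : {p q a x : Fin n} → (p , q) ≈ₑ (a , x) → key a x ≡ (p , q) ⊎ key a x ≡ (q , p)
key-either {a = a} {x} pq≈ with key-cases a x | pq≈
... | inj₁ (eq , _) | inj₁ (refl , refl) = inj₂ eq
... | inj₁ (eq , _) | inj₂ (refl , refl) = inj₁ eq
... | inj₂ (eq , _) | inj₁ (refl , refl) = inj₁ eq
... | inj₂ (eq , _) | inj₂ (refl , refl) = inj₂ eq

-- h c i j: the pair (i , j) has colour c.
ColourRel : ℕ → ℕ → Set
ColourRel n s = Fin s → Fin n → Fin n → Bool

infixr 5 _⊕_
_⊕_ : ColourRel n s → ColourRel n s → ColourRel n s
(h ⊕ h′) c i j = h c i j ∨ h′ c i j

∅ : ColourRel n s
∅ c i j = false

infix 4 _≐_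
_≐_ : ColourRel n s → ColourRel n s → Set
h ≐ h′ = ∀ c i j → h c i j ≡ h′ c i j

paint : Edge n → Fin s → ColourRel n s
paint e x c i j = (proj₁ e == i) ∧ (proj₂ e == j) ∧ (x == c)

paint⁻ : {e : Edge n} {x c : Fin s} {i j : Fin n} → T (paint e x c i j) → e ≡ (i , j) × x ≡ c
paint⁻ {e = e} {x} {c} {i} {j} t with Equivalence.to (T-∧ {proj₁ e == i}) t
... | e₁≡i , t′ with Equivalence.to (T-∧ {proj₂ e == j}) t′
... | e₂≡j , x≡c = cong₂ _,_ (==⇒≡ e₁≡i) (==⇒≡ e₂≡j) , ==⇒≡ x≡c

paint⁺ : {e : Edge n} {x c : Fin s} {i j : Fin n} → e ≡ (i , j) → x ≡ c → T (paint e x c i j)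
paint⁺ {c = c} {i} {j} refl refl =
  Equivalence.from (T-∧ {i == i}) (==-refl i , Equivalence.from (T-∧ {j == j}) (==-refl j , ==-refl c))

≐-refl : {h : ColourRel n s} → h ≐ h
≐-refl c i j = refl

≐-sym : {h h′ : ColourRel n s} → h ≐ h′ → h′ ≐ h
≐-sym eq c i j = sym (eq c i j)

⊕-cong : {h₁ h₂ h₁′ h₂′ : ColourRel n s} → h₁ ≐ h₁′ → h₂ ≐ h₂′ → h₁ ⊕ h₂ ≐ h₁′ ⊕ h₂′
⊕-cong eq₁ eq₂ c i j = cong₂ _∨_ (eq₁ c i j) (eq₂ c i j)

⊕-assoc : (h₁ h₂ h₃ : ColourRel n s) → (h₁ ⊕ h₂) ⊕ h₃ ≐ h₁ ⊕ (h₂ ⊕ h₃)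
⊕-assoc h₁ h₂ h₃ c i j = ∨-assoc (h₁ c i j) _ _

⊕-swap : (h₁ h₂ h₃ : ColourRel n s) → h₁ ⊕ (h₂ ⊕ h₃) ≐ h₂ ⊕ (h₁ ⊕ h₃)
⊕-swap h₁ h₂ h₃ c i j = trans (sym (∨-assoc (h₁ c i j) _ _))
  (trans (cong (_∨ h₃ c i j) (∨-comm (h₁ c i j) _)) (∨-assoc (h₂ c i j) _ _))

Extensional : (ColourRel n s → ℕ) → Set
Extensional g = ∀ {h h′} → h ≐ h′ → g h ≡ g h′

-- ∑col E g sums g over the colour relations of the s-colourings of the edge list E.
∑col : List (Edge n) → (ColourRel n s → ℕ) → ℕ
∑col         []      g = g ∅
∑col {s = s} (e ∷ E) g = ∑ (allFin s) λ x → ∑col E (λ h → g (paint e x ⊕ h))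

Extensional-⊕ˡ : {g : ColourRel n s → ℕ} (h : ColourRel n s) → Extensional g → Extensional (λ h′ → g (h ⊕ h′))
Extensional-⊕ˡ h ext eq = ext (⊕-cong ≐-refl eq)

Supported : List (Edge n) → ColourRel n s → Set
Supported E h = ∀ c i j → T (h c i j) → (i , j) ∈ E

∑col-cong-supported : (E : List (Edge n)) {g g′ : ColourRel n s → ℕ} →
  (∀ h → Supported E h → g h ≡ g′ h) → ∑col E g ≡ ∑col E g′
∑col-cong-supported         []      eq = eq ∅ (λ c i j ())
∑col-cong-supported {s = s} (e ∷ E) eq = ∑-cong (allFin s) λ x →
  ∑col-cong-supported E λ h supp → eq _ (paint-⊕-supported x supp)
  where
  paint-⊕-supported : ∀ x {h} → Supported E h → Supported (e ∷ E) (paint e x ⊕ h)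
  paint-⊕-supported x supp c i j t with Equivalence.to (T-∨ {paint e x c i j}) t
  ... | inj₁ t′ = here (sym (proj₁ (paint⁻ {e = e} {x} {c} t′)))
  ... | inj₂ t′ = there (supp c i j t′)

∑col-cong : (E : List (Edge n)) {g g′ : ColourRel n s → ℕ} → (∀ h → g h ≡ g′ h) → ∑col E g ≡ ∑col E g′
∑col-cong E eq = ∑col-cong-supported E (λ h _ → eq h)

∑col-mono : (E : List (Edge n)) {g g′ : ColourRel n s → ℕ} → (∀ h → g h ≤ g′ h) → ∑col E g ≤ ∑col E g′
∑col-mono         []      le = le ∅
∑col-mono {s = s} (e ∷ E) le = ∑-mono (allFin s) λ x → ∑col-mono E λ h → le _

∑col-+ : (E : List (Edge n)) (g g′ : ColourRel n s → ℕ) → ∑col E (λ h → g h + g′ h) ≡ ∑col E g + ∑col E g′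
∑col-+         []      g g′ = refl
∑col-+ {s = s} (e ∷ E) g g′ = trans (∑-cong (allFin s) λ x → ∑col-+ E _ _) (∑-+ (allFin s) _ _)

∑col-*ˡ : (E : List (Edge n)) (a : ℕ) (g : ColourRel n s → ℕ) → ∑col E (λ h → a * g h) ≡ a * ∑col E g
∑col-*ˡ         []      a g = refl
∑col-*ˡ {s = s} (e ∷ E) a g = trans (∑-cong (allFin s) λ x → ∑col-*ˡ E a _) (∑-*ˡ (allFin s) a _)

∑col-++ : (E₁ E₂ : List (Edge n)) {g : ColourRel n s → ℕ} → Extensional g →
  ∑col (E₁ ++ E₂) g ≡ ∑col E₁ (λ h₁ → ∑col E₂ (λ h₂ → g (h₁ ⊕ h₂)))
∑col-++         []       E₂ ext = refl
∑col-++ {s = s} (e ∷ E₁) E₂ ext = ∑-cong (allFin s) λ x →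
  trans (∑col-++ E₁ E₂ (Extensional-⊕ˡ (paint e x) ext))
        (∑col-cong E₁ λ h₁ → ∑col-cong E₂ λ h₂ → ext (≐-sym (⊕-assoc (paint e x) h₁ h₂)))

∑col-↭ : {E E′ : List (Edge n)} → E ↭ E′ → {g : ColourRel n s → ℕ} → Extensional g → ∑col E g ≡ ∑col E′ g
∑col-↭         ↭.refl                     ext = refl
∑col-↭ {s = s} (↭.prep e p)               ext = ∑-cong (allFin s) λ x → ∑col-↭ p (Extensional-⊕ˡ (paint e x) ext)
∑col-↭ {s = s} (↭.swap {ys = E′} e₁ e₂ p) ext = trans
  (∑-cong (allFin s) λ x → ∑-cong (allFin s) λ y →
     trans (∑col-↭ p (Extensional-⊕ˡ (paint e₂ y) (Extensional-⊕ˡ (paint e₁ x) ext)))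
           (∑col-cong E′ λ h → ext (⊕-swap (paint e₁ x) (paint e₂ y) h)))
  (∑-swap (allFin s) (allFin s) _)
∑col-↭         (↭.trans p q)              ext = trans (∑col-↭ p ext) (∑col-↭ q ext)

colourRel : List (Edge n) → Vec (Fin s) m → ColourRel n s
colourRel E σ c i j = any (λ e → (proj₁ (proj₁ e) == i) ∧ (proj₂ (proj₁ e) == j) ∧ (proj₂ e == c)) (zip E (toList σ))

∑-colourRel≡∑col : (E : List (Edge n)) (g : ColourRel n s → ℕ) →
  ∑ (allVecs (allFin s) (length E)) (λ σ → g (colourRel E σ)) ≡ ∑col E g
∑-colourRel≡∑col         []      g = +-identityʳ (g ∅)
∑-colourRel≡∑col {s = s} (e ∷ E) g = trans (∑-concatMap (allFin s) _ _) (∑-cong (allFin s) λ x →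
  trans (∑-map (allVecs (allFin s) (length E)) (x ∷_) _) (∑-colourRel≡∑col E (λ h → g (paint e x ⊕ h))))

∑col-*ʳ : (E : List (Edge n)) (a : ℕ) (g : ColourRel n s → ℕ) → ∑col E (λ h → g h * a) ≡ ∑col E g * a
∑col-*ʳ E a g = trans (∑col-cong E λ h → *-comm (g h) a) (trans (∑col-*ˡ E a g) (*-comm a (∑col E g)))

bools : List Bool
bools = true ∷ false ∷ []

∈-bools : (b : Bool) → b ∈ bools
∈-bools true  = here refl
∈-bools false = there (here refl)

∈-allVecs : (xs : List A) (v : Vec A m) → (∀ i → lookup v i ∈ xs) → v ∈ allVecs xs m
∈-allVecs xs []      _  = here refl
∈-allVecs xs (x ∷ v) v∈ = ∈-concatMap⁺ (λ y → map (y ∷_) (allVecs xs _))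
  (lose (v∈ Fin.zero) (∈-map⁺ (x ∷_) (∈-allVecs xs v (λ i → v∈ (Fin.suc i)))))

any-false : {A : Set} {p : A → Bool} {xs : List A} {x : A} → any p xs ≡ false → x ∈ xs → p x ≡ false
any-false {p = p} {xs = y ∷ _} eq (here refl) with p y
... | false = refl
any-false {p = p} {xs = y ∷ _} eq (there x∈) with p y
... | false = any-false eq x∈

all-false : {A : Set} {p : A → Bool} {xs : List A} → all p xs ≡ false → ∃ λ x → x ∈ xs × p x ≡ false
all-false {p = p} {xs = y ∷ ys} eq with p y in py
... | false = y , here refl , py
... | true  with all-false eq
...   | x , x∈ , px = x , there x∈ , px

Clique : ColourRel n s → Fin s → ℕ → Set
Clique {n} h c m = Σ (Vec Bool n) λ S → size S ≡ m ×
  (∀ i j → toℕ i < toℕ j → T (lookup S i) → T (lookup S j) → T (h c i j))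

Valid : Vec ℕ s → ColourRel n s → Set
Valid k h = ∀ c → ¬ Clique h c (lookup k c)

cliqueᵇ : ColourRel n s → Fin s → ℕ → Bool
cliqueᵇ {n} h c m = any (λ S → (size S ≡ᵇ m) ∧
  all (λ p → not (lookup S (proj₁ p) ∧ lookup S (proj₂ p)) ∨ h c (proj₁ p) (proj₂ p)) (pairs n))
  (allVecs bools n)

validᵇ : Vec ℕ s → ColourRel n s → Bool
validᵇ {s} k h = all (λ c → not (cliqueᵇ h c (lookup k c))) (allFin s)

-- containsClique and valid use local connectives of Defs, so these two proofs
-- reduce them by with-abstraction on their arguments.
containsClique-sound : {G : Graph n} {σ : Colouring s G} {c : Fin s} {m : ℕ} →
  T (containsClique G σ c m) → Clique (hasColour G σ) c m
containsClique-sound {n = n} {G = G} {σ} {c} {m} t with find (any⁻ _ (allVecs bools n) t)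
... | S , _ , tS with Equivalence.to (T-∧ {size S ≡ᵇ m}) tS
... | size≡ , cliqueS = S , ≡ᵇ⇒≡ (size S) m size≡ , edge
  where
  edge : ∀ i j → toℕ i < toℕ j → T (lookup S i) → T (lookup S j) → T (hasColour G σ c i j)
  edge i j i<j Si Sj with lookup S i | lookup S j | All.lookup (all⁺ _ (pairs n) cliqueS) (∈-pairs⁺ i<j)
  ... | true | true | t′ = t′

containsClique-complete : {G : Graph n} {σ : Colouring s G} {c : Fin s} {m : ℕ} →
  Clique (hasColour G σ) c m → T (containsClique G σ c m)
containsClique-complete {n = n} {G = G} {σ} {c} {m} (S , size≡ , clique) with containsClique G σ c m in eq
... | true  = _
... | false with size S ≡ᵇ m | ≡⇒≡ᵇ (size S) m size≡ | any-false {xs = allVecs bools n} eq (∈-allVecs bools S (λ i → ∈-bools _))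
... | true | _ | eqS with all-false {xs = pairs n} eqS
... | (i , j) , ij∈ , eqij with lookup S i | lookup S j | clique i j (∈-pairs⁻ ij∈)
... | true  | true  | edge = subst T eqij (edge _ _)
... | true  | false | _    = ⊥-elim (subst T eqij _)
... | false | _     | _    = ⊥-elim (subst T eqij _)

valid-sound : {G : Graph n} {k : Vec ℕ s} {σ : Colouring s G} → T (valid G k σ) → Valid k (hasColour G σ)
valid-sound {s = s} {G = G} {k} {σ} t c clique
  with containsClique G σ c (lookup k c) in eq | All.lookup (all⁺ _ (allFin s) t) (∈-allFin c)
... | true  | ()
... | false | _ = subst T eq (containsClique-complete {G = G} {σ} clique)

valid-complete : {G : Graph n} {k : Vec ℕ s} {σ : Colouring s G} → Valid k (hasColour G σ) → T (valid G k σ)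
valid-complete {s = s} {G = G} {k} {σ} v with valid G k σ in eq
... | true  = _
... | false with all-false {xs = allFin s} eq
... | c , _ , eqc with containsClique G σ c (lookup k c) in eq′
... | true  = v c (containsClique-sound {G = G} {σ} (subst T (sym eq′) _))
... | false = ⊥-elim (subst T eqc _)

cliqueᵇ-sound : {h : ColourRel n s} {c : Fin s} {m : ℕ} → T (cliqueᵇ h c m) → Clique h c m
cliqueᵇ-sound {n = n} {h = h} {c} {m} t with find (any⁻ _ (allVecs bools n) t)
... | S , _ , tS with Equivalence.to (T-∧ {size S ≡ᵇ m}) tS
... | size≡ , cliqueS = S , ≡ᵇ⇒≡ (size S) m size≡ , λ i j i<j Si Sj →
  T-⇒ᵇ (All.lookup (all⁺ _ (pairs n) cliqueS) (∈-pairs⁺ i<j)) (Equivalence.from T-∧ (Si , Sj))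

cliqueᵇ-complete : {h : ColourRel n s} {c : Fin s} {m : ℕ} → Clique h c m → T (cliqueᵇ h c m)
cliqueᵇ-complete {n = n} {h = h} {c} {m} (S , size≡ , clique) =
  any⁺ _ (lose (∈-allVecs bools S (λ i → ∈-bools _))
    (Equivalence.from T-∧ (≡⇒≡ᵇ (size S) m size≡ , all⁻ _ (All.tabulate λ {p} p∈ →
      ⇒ᵇ-T λ t → let (Si , Sj) = Equivalence.to T-∧ t in clique _ _ (∈-pairs⁻ p∈) Si Sj))))

validᵇ-sound : {k : Vec ℕ s} {h : ColourRel n s} → T (validᵇ k h) → Valid k h
validᵇ-sound {s = s} {h = h} t c clique =
  T-not⁻ (All.lookup (all⁺ _ (allFin s) t) (∈-allFin c)) (cliqueᵇ-complete {h = h} clique)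

validᵇ-complete : {k : Vec ℕ s} {h : ColourRel n s} → Valid k h → T (validᵇ k h)
validᵇ-complete {s = s} {k = k} {h} v = all⁻ (λ c → not (cliqueᵇ h c (lookup k c))) {xs = allFin s}
  (All.tabulate λ {c} _ → T-not⁺ λ t → v c (cliqueᵇ-sound {h = h} t))

validIndicator : Vec ℕ s → ColourRel n s → ℕ
validIndicator k h = indicator (validᵇ k h)

Valid-antitone : {k : Vec ℕ s} {h h′ : ColourRel n s} →
  (∀ c i j → toℕ i < toℕ j → T (h c i j) → T (h′ c i j)) → Valid k h′ → Valid k h
Valid-antitone h⊆h′ valid′ c (S , size≡ , clique) =
  valid′ c (S , size≡ , λ i j i<j Si Sj → h⊆h′ c i j i<j (clique i j i<j Si Sj))

validᵇ-antitone : {k : Vec ℕ s} {h h′ : ColourRel n s} →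
  (∀ c i j → toℕ i < toℕ j → T (h c i j) → T (h′ c i j)) → T (validᵇ k h′) → T (validᵇ k h)
validᵇ-antitone {k = k} {h} {h′} h⊆h′ t =
  validᵇ-complete {k = k} (Valid-antitone {k = k} h⊆h′ (validᵇ-sound {k = k} {h′} t))

infix 4 _≐<_
_≐<_ : ColourRel n s → ColourRel n s → Set
h ≐< h′ = ∀ c i j → toℕ i < toℕ j → h c i j ≡ h′ c i j

validᵇ-cong : {k : Vec ℕ s} {h h′ : ColourRel n s} → h ≐< h′ → validᵇ k h ≡ validᵇ k h′
validᵇ-cong {k = k} h≡h′ = T-ext (validᵇ-antitone {k = k} λ c i j i<j → subst T (sym (h≡h′ c i j i<j)))
                                 (validᵇ-antitone {k = k} λ c i j i<j → subst T (h≡h′ c i j i<j))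

validIndicator-extensional : (k : Vec ℕ s) → Extensional {n} (validIndicator k)
validIndicator-extensional k h≐h′ = cong indicator (validᵇ-cong {k = k} λ c i j _ → h≐h′ c i j)

valid≡validᵇ : (G : Graph n) (k : Vec ℕ s) (σ : Colouring s G) → valid G k σ ≡ validᵇ k (hasColour G σ)
valid≡validᵇ G k σ = T-ext (λ t → validᵇ-complete {k = k} (valid-sound {G = G} {k} t))
                          (λ t → valid-complete {G = G} {k} (validᵇ-sound {k = k} t))

F≡∑col : (G : Graph n) (k : Vec ℕ s) → F G k ≡ ∑col (edges G) (validIndicator k)
F≡∑col {s = s} G k = begin
  F G k                                                               ≡⟨ length-filterᵇ (valid G k) (allColourings s G) ⟩
  ∑ (allColourings s G) (λ σ → indicator (valid G k σ))               ≡⟨ ∑-cong (allColourings s G) (λ σ → cong indicator (valid≡validᵇ G k σ)) ⟩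
  ∑ (allColourings s G) (λ σ → validIndicator k (hasColour G σ))      ≡⟨ ∑-colourRel≡∑col (edges G) (validIndicator k) ⟩
  ∑col (edges G) (validIndicator k)                                   ∎
  where open ≡-Reasoning

F-cong : {G H : Graph n} (k : Vec ℕ s) → (∀ i j → adj G i j ≡ adj H i j) → F G k ≡ F H k
F-cong {n = n} {G = G} {H} k adj≡ = begin
  F G k                              ≡⟨ F≡∑col G k ⟩
  ∑col (edges G) (validIndicator k)  ≡⟨ cong (λ E → ∑col E (validIndicator k)) (filterᵇ-cong (λ e → adj≡ _ _) (pairs n)) ⟩
  ∑col (edges H) (validIndicator k)  ≡⟨ F≡∑col H k ⟨
  F H k                              ∎
  where open ≡-Reasoning

-- Relabelling the vertices

size≡∑ᶠ : (S : Vec Bool n) → size S ≡ ∑ᶠ (λ i → indicator (lookup S i))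
size≡∑ᶠ []          = refl
size≡∑ᶠ (true ∷ S)  = cong suc (size≡∑ᶠ S)
size≡∑ᶠ (false ∷ S) = size≡∑ᶠ S

permuteSet : Permutation′ n → Vec Bool n → Vec Bool n
permuteSet π S = tabulate (λ i → lookup S (π ⟨$⟩ʳ i))

size-permuteSet : (π : Permutation′ n) (S : Vec Bool n) → size (permuteSet π S) ≡ size S
size-permuteSet π S = begin
  size (permuteSet π S)                           ≡⟨ size≡∑ᶠ (permuteSet π S) ⟩
  ∑ᶠ (λ i → indicator (lookup (permuteSet π S) i)) ≡⟨ sum-cong-≗ (λ i → cong indicator (lookup∘tabulate (λ j → lookup S (π ⟨$⟩ʳ j)) i)) ⟩
  ∑ᶠ (λ i → indicator (lookup S (π ⟨$⟩ʳ i)))     ≡⟨ sum-permute (λ i → indicator (lookup S i)) π ⟨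
  ∑ᶠ (λ i → indicator (lookup S i))              ≡⟨ size≡∑ᶠ S ⟨
  size S                                          ∎
  where open ≡-Reasoning

Clique-transport : (π : Permutation′ n) {h h′ : ColourRel n s} {c : Fin s} {m : ℕ} →
  (∀ i j → toℕ i < toℕ j → T (h c (π ⟨$⟩ʳ i) (π ⟨$⟩ʳ j)) ⊎ T (h c (π ⟨$⟩ʳ j) (π ⟨$⟩ʳ i)) → T (h′ c i j)) →
  Clique h c m → Clique h′ c m
Clique-transport π {h′ = h′} {c} transfer (S , size≡ , clique) =
  permuteSet π S , trans (size-permuteSet π S) size≡ , edge
  where
  inS : ∀ {i} → T (lookup (permuteSet π S) i) → T (lookup S (π ⟨$⟩ʳ i))
  inS {i} = subst T (lookup∘tabulate (λ j → lookup S (π ⟨$⟩ʳ j)) i)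
  edge : ∀ i j → toℕ i < toℕ j → T (lookup (permuteSet π S) i) → T (lookup (permuteSet π S) j) → T (h′ c i j)
  edge i j i<j Si Sj with <-cmp (toℕ (π ⟨$⟩ʳ i)) (toℕ (π ⟨$⟩ʳ j))
  ... | tri< πi<πj _ _ = transfer i j i<j (inj₁ (clique _ _ πi<πj (inS Si) (inS Sj)))
  ... | tri> _ _ πj<πi = transfer i j i<j (inj₂ (clique _ _ πj<πi (inS Sj) (inS Si)))
  ... | tri≈ _ πi≡πj _ = ⊥-elim (<-irrefl (cong toℕ (π-injective (toℕ-injective πi≡πj))) i<j)
    where
    π-injective : ∀ {x y} → π ⟨$⟩ʳ x ≡ π ⟨$⟩ʳ y → x ≡ y
    π-injective {x} {y} eq = trans (sym (inverseˡ π)) (trans (cong (π ⟨$⟩ˡ_) eq) (inverseˡ π))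

Upper : ColourRel n s → Set
Upper h = ∀ c i j → T (h c i j) → toℕ i < toℕ j

-- Colourings only colour pairs i < j, an order π need not preserve; hence both orientations.
relabel : Permutation′ n → ColourRel n s → ColourRel n s
relabel π h c i j = h c (π ⟨$⟩ʳ i) (π ⟨$⟩ʳ j) ∨ h c (π ⟨$⟩ʳ j) (π ⟨$⟩ʳ i)

Clique-relabel⁺ : (π : Permutation′ n) {h : ColourRel n s} {c : Fin s} {m : ℕ} →
  Clique h c m → Clique (relabel π h) c m
Clique-relabel⁺ π {h} {c} = Clique-transport π {h} {relabel π h} {c}
  (λ i j _ → Equivalence.from (T-∨ {h c (π ⟨$⟩ʳ i) (π ⟨$⟩ʳ j)}))

Clique-relabel⁻ : (π : Permutation′ n) {h : ColourRel n s} {c : Fin s} {m : ℕ} → Upper h →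
  Clique (relabel π h) c m → Clique h c m
Clique-relabel⁻ π {h} {c} upper = Clique-transport (flip π) {relabel π h} {h} {c} back
  where
  restore : ∀ {i j} → T (h c (π ⟨$⟩ʳ (π ⟨$⟩ˡ i)) (π ⟨$⟩ʳ (π ⟨$⟩ˡ j))) → T (h c i j)
  restore = subst₂ (λ a b → T (h c a b)) (inverseʳ π) (inverseʳ π)
  back : ∀ i j → toℕ i < toℕ j →
    T (relabel π h c (π ⟨$⟩ˡ i) (π ⟨$⟩ˡ j)) ⊎ T (relabel π h c (π ⟨$⟩ˡ j) (π ⟨$⟩ˡ i)) → T (h c i j)
  back i j i<j (inj₁ t) with Equivalence.to T-∨ t
  ... | inj₁ t′ = restore t′
  ... | inj₂ t′ = ⊥-elim (<-asym i<j (upper c j i (restore t′)))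
  back i j i<j (inj₂ t) with Equivalence.to T-∨ t
  ... | inj₁ t′ = ⊥-elim (<-asym i<j (upper c j i (restore t′)))
  ... | inj₂ t′ = restore t′

validᵇ-relabel : (π : Permutation′ n) {k : Vec ℕ s} {h : ColourRel n s} → Upper h →
  validᵇ k (relabel π h) ≡ validᵇ k h
validᵇ-relabel π {k} {h} upper = T-ext
  (λ t → validᵇ-complete {k = k} λ c clique → validᵇ-sound {k = k} t c (Clique-relabel⁺ π {h} clique))
  (λ t → validᵇ-complete {k = k} λ c clique → validᵇ-sound {k = k} {h} t c (Clique-relabel⁻ π upper clique))

transpose-right : (u w : Fin n) → transpose u w ⟨$⟩ʳ w ≡ u
transpose-right u w with w ≟ u
... | yes w≡u = w≡u
... | no  _   rewrite dec-true (w ≟ w) refl = refl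

transpose-other : {u w x : Fin n} → x ≢ u → x ≢ w → transpose u w ⟨$⟩ʳ x ≡ x
transpose-other {u = u} {w} {x} x≢u x≢w rewrite dec-false (x ≟ u) x≢u | dec-false (x ≟ w) x≢w = refl

paint-relabel : {u w x : Fin n} {d c : Fin s} {i j : Fin n} → x ≢ u → x ≢ w → toℕ i < toℕ j →
  relabel (transpose u w) (paint (key u x) d) c i j ≡ paint (key w x) d c i j
paint-relabel {n = n} {u = u} {w} {x} {d} {c} {i} {j} x≢u x≢w i<j = T-ext to from
  where
  π : Permutation′ n
  π = transpose u w
  unmove : {p q : Fin n} → (π ⟨$⟩ʳ p , π ⟨$⟩ʳ q) ≈ₑ (u , x) → (p , q) ≈ₑ (w , x)
  unmove = ≈ₑ-map (π ⟨$⟩ˡ_) (inverseˡ π) (inverseˡ π) (transpose-right w u) (transpose-other x≢w x≢u)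
  move : {p q : Fin n} → (p , q) ≈ₑ (w , x) → (π ⟨$⟩ʳ p , π ⟨$⟩ʳ q) ≈ₑ (u , x)
  move = ≈ₑ-map (π ⟨$⟩ʳ_) refl refl (transpose-right u w) (transpose-other x≢u x≢w)
  painted-by-u : {p q : Fin n} → T (paint (key u x) d c p q) → (p , q) ≈ₑ (u , x) × d ≡ c
  painted-by-u t with paint⁻ {e = key u x} {d} {c} t
  ... | e , d≡c = subst (_≈ₑ (u , x)) e (key-≈ₑ u x) , d≡c
  to : T (relabel π (paint (key u x) d) c i j) → T (paint (key w x) d c i j)
  to t with Equivalence.to (T-∨ {paint (key u x) d c (π ⟨$⟩ʳ i) (π ⟨$⟩ʳ j)}) t
  ... | inj₁ t′ = let (≈ux , d≡c) = painted-by-u t′ in paint⁺ (key-unique i<j (unmove ≈ux)) d≡c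
  ... | inj₂ t′ = let (≈ux , d≡c) = painted-by-u t′ in paint⁺ (key-unique i<j (≈ₑ-swap (unmove ≈ux))) d≡c
  from : T (paint (key w x) d c i j) → T (relabel π (paint (key u x) d) c i j)
  from t with paint⁻ {e = key w x} {d} {c} t
  ... | e , d≡c with key-either (move (subst (_≈ₑ (w , x)) e (key-≈ₑ w x)))
  ...   | inj₁ e′ = Equivalence.from T-∨ (inj₁ (paint⁺ e′ d≡c))
  ...   | inj₂ e′ = Equivalence.from (T-∨ {paint (key u x) d c (π ⟨$⟩ʳ i) (π ⟨$⟩ʳ j)}) (inj₂ (paint⁺ e′ d≡c))

Upper-⊕ : {h h′ : ColourRel n s} → Upper h → Upper h′ → Upper (h ⊕ h′)
Upper-⊕ {h = h} up up′ c i j t with Equivalence.to (T-∨ {h c i j}) t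
... | inj₁ t′ = up c i j t′
... | inj₂ t′ = up′ c i j t′

Upper-paint : {a x : Fin n} {d : Fin s} → a ≢ x → Upper (paint (key a x) d)
Upper-paint {a = a} {x} {d} a≢x c i j t with paint⁻ {e = key a x} {d} {c} t
... | refl , _ = key-ordered a≢x

relabel-⊕ : (π : Permutation′ n) (h h′ : ColourRel n s) → relabel π (h ⊕ h′) ≐ relabel π h ⊕ relabel π h′
relabel-⊕ π h h′ c i j = interchange (CommutativeMonoid.commutativeSemigroup ∨-commutativeMonoid)
  (h c (π ⟨$⟩ʳ i) (π ⟨$⟩ʳ j)) (h′ c (π ⟨$⟩ʳ i) (π ⟨$⟩ʳ j)) (h c (π ⟨$⟩ʳ j) (π ⟨$⟩ʳ i)) (h′ c (π ⟨$⟩ʳ j) (π ⟨$⟩ʳ i))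

Avoids : Fin n → Fin n → Fin n → Set
Avoids u w i = i ≢ u × i ≢ w

relabel-transpose-avoiding : {u w : Fin n} {h : ColourRel n s} → Upper h →
  (∀ c i j → T (h c i j) → Avoids u w i × Avoids u w j) → h ≐< relabel (transpose u w) h
relabel-transpose-avoiding {n = n} {u = u} {w} {h} upper avoids c i j i<j = T-ext to from
  where
  π : Permutation′ n
  π = transpose u w
  fixed : ∀ {y} → Avoids u w y → π ⟨$⟩ʳ y ≡ y
  fixed (y≢u , y≢w) = transpose-other y≢u y≢w
  fixed-by-image : ∀ {y} → Avoids u w (π ⟨$⟩ʳ y) → π ⟨$⟩ʳ y ≡ y
  fixed-by-image {y} (πy≢u , πy≢w) = trans (sym (transpose-other πy≢w πy≢u)) (inverseˡ π)
  to : T (h c i j) → T (relabel π h c i j)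
  to t = let (ai , aj) = avoids c i j t in
    Equivalence.from T-∨ (inj₁ (subst₂ (λ a b → T (h c a b)) (sym (fixed ai)) (sym (fixed aj)) t))
  from : T (relabel π h c i j) → T (h c i j)
  from t with Equivalence.to (T-∨ {h c (π ⟨$⟩ʳ i) (π ⟨$⟩ʳ j)}) t
  ... | inj₁ t′ = let (ai , aj) = avoids c _ _ t′ in
    subst₂ (λ a b → T (h c a b)) (fixed-by-image ai) (fixed-by-image aj) t′
  ... | inj₂ t′ = let (aj , ai) = avoids c _ _ t′ in
    ⊥-elim (<-asym i<j (upper c j i (subst₂ (λ a b → T (h c a b)) (fixed-by-image aj) (fixed-by-image ai) t′)))

validᵇ-transpose : {k : Vec ℕ s} {u w : Fin n} {hu hw : ColourRel n s} → Upper hu →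
  hw ≐< relabel (transpose u w) hu → validᵇ k hu ≡ validᵇ k hw
validᵇ-transpose {k = k} {u} {w} upper hw≐ =
  trans (sym (validᵇ-relabel (transpose u w) {k} upper)) (validᵇ-cong {k = k} λ c i j i<j → sym (hw≐ c i j i<j))

≐<-relabel-⊕ : {π : Permutation′ n} {hu hu′ hw hw′ : ColourRel n s} →
  hw ≐< relabel π hu → hw′ ≐< relabel π hu′ → hw ⊕ hw′ ≐< relabel π (hu ⊕ hu′)
≐<-relabel-⊕ {π = π} {hu} {hu′} eq eq′ c i j i<j =
  trans (cong₂ _∨_ (eq c i j i<j) (eq′ c i j i<j)) (sym (relabel-⊕ π hu hu′ c i j))

-- Transposing u and w maps each coloured edge ux to wx, and validity is invariant under relabelling.
star-transpose : (k : Vec ℕ s) {u w : Fin n} (N : List (Fin n)) → (∀ {x} → x ∈ N → Avoids u w x) →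
  {hu hw : ColourRel n s} → Upper hu → hw ≐< relabel (transpose u w) hu →
  ∑col (map (key u) N) (λ h → validIndicator k (hu ⊕ h)) ≡ ∑col (map (key w) N) (λ h → validIndicator k (hw ⊕ h))
star-transpose k {u} {w} [] _ {hu} {hw} upper hw≐ = cong indicator (validᵇ-transpose {k = k} {u} {w}
  (Upper-⊕ upper λ _ _ _ ()) (≐<-relabel-⊕ {π = transpose u w} {hu} {∅} {hw} {∅} hw≐ λ _ _ _ _ → refl))
star-transpose {s = s} {n = n} k {u} {w} (x ∷ N) avoids {hu} {hw} upper hw≐ = ∑-cong (allFin s) λ d → begin
  ∑col (map (key u) N) (λ h → χ (hu ⊕ paint (key u x) d ⊕ h))
    ≡⟨ ∑col-cong (map (key u) N) (λ h → validIndicator-extensional k (≐-sym (⊕-assoc hu (paint (key u x) d) h))) ⟩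
  ∑col (map (key u) N) (λ h → χ ((hu ⊕ paint (key u x) d) ⊕ h))
    ≡⟨ star-transpose k N (avoids ∘ there)
         (Upper-⊕ upper (Upper-paint {d = d} λ u≡x → x≢u (sym u≡x)))
         (≐<-relabel-⊕ {π = transpose u w} {hu} {paint (key u x) d} {hw} hw≐
            λ c i j i<j → sym (paint-relabel {u = u} {w} {x} {d} x≢u x≢w i<j)) ⟩
  ∑col (map (key w) N) (λ h → χ ((hw ⊕ paint (key w x) d) ⊕ h))
    ≡⟨ ∑col-cong (map (key w) N) (λ h → validIndicator-extensional k (⊕-assoc hw (paint (key w x) d) h)) ⟩
  ∑col (map (key w) N) (λ h → χ (hw ⊕ paint (key w x) d ⊕ h)) ∎
  where
  open ≡-Reasoning
  χ : ColourRel n s → ℕ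
  χ = validIndicator k
  x≢u : x ≢ u
  x≢u = proj₁ (avoids (here refl))
  x≢w : x ≢ w
  x≢w = proj₂ (avoids (here refl))

-- Factorisation at a non-edge

adjᵉ : Graph n → Edge n → Bool
adjᵉ G e = adj G (proj₁ e) (proj₂ e)

edgesWhere : Graph n → (Edge n → Bool) → List (Edge n)
edgesWhere {n} G p = filterᵇ (λ e → adjᵉ G e ∧ p e) (pairs n)

∈-edgesWhere⁻ : {G : Graph n} {p : Edge n → Bool} {i j : Fin n} → (i , j) ∈ edgesWhere G p →
  T (adj G i j) × T (p (i , j)) × toℕ i < toℕ j
∈-edgesWhere⁻ {G = G} {p} {i} {j} e∈ with ∈-filterᵇ⁻ (λ e → adjᵉ G e ∧ p e) e∈
... | e∈pairs , t with Equivalence.to (T-∧ {adj G i j}) t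
... | adjG , pe = adjG , pe , ∈-pairs⁻ e∈pairs

edgesWhere-split : (G : Graph n) (p q : Edge n → Bool) →
  edgesWhere G p ↭ edgesWhere G (λ e → p e ∧ q e) ++ edgesWhere G (λ e → p e ∧ not (q e))
edgesWhere-split {n} G p q = ↭-trans (filterᵇ-split (λ e → adjᵉ G e ∧ p e) q (pairs n))
  (↭-reflexive (cong₂ _++_ (filterᵇ-cong (λ e → ∧-assoc (adjᵉ G e) (p e) (q e)) (pairs n))
                           (filterᵇ-cong (λ e → ∧-assoc (adjᵉ G e) (p e) (not (q e))) (pairs n))))

edgesWhere-cong : {G H : Graph n} (p : Edge n → Bool) → (∀ e → T (p e) → adjᵉ G e ≡ adjᵉ H e) →
  edgesWhere G p ≡ edgesWhere H p
edgesWhere-cong {n} {G} {H} p agree = filterᵇ-cong same (pairs n)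
  where
  same : ∀ e → adjᵉ G e ∧ p e ≡ adjᵉ H e ∧ p e
  same e with p e in pe
  ... | true  = trans (∧-identityʳ _) (trans (agree e (subst T (sym pe) _)) (sym (∧-identityʳ _)))
  ... | false = trans (∧-zeroʳ (adjᵉ G e)) (sym (∧-zeroʳ (adjᵉ H e)))

touches : Fin n → Edge n → Bool
touches v e = (proj₁ e == v) ∨ (proj₂ e == v)

touches⁻ : {v i j : Fin n} → T (touches v (i , j)) → i ≡ v ⊎ j ≡ v
touches⁻ {v = v} {i} {j} t with Equivalence.to (T-∨ {i == v}) t
... | inj₁ i≡v = inj₁ (==⇒≡ i≡v)
... | inj₂ j≡v = inj₂ (==⇒≡ j≡v)

¬touches⁻ : {v i j : Fin n} → T (not (touches v (i , j))) → i ≢ v × j ≢ v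
¬touches⁻ t = (λ i≡v → T-not⁻ t (Equivalence.from T-∨ (inj₁ (≡⇒== i≡v))))
            , (λ j≡v → T-not⁻ t (Equivalence.from T-∨ (inj₂ (≡⇒== j≡v))))

Touches : Fin n → ColourRel n s → Set
Touches v h = ∀ c i j → T (h c i j) → i ≡ v ⊎ j ≡ v

-- A clique of h ⊕ hα ⊕ hβ cannot contain both u and w, as uw has no colour;
-- so it avoids w and is a clique of h ⊕ hα, or it avoids u and is one of h ⊕ hβ.
Valid-⊕-split : {k : Vec ℕ s} {u w : Fin n} {h hα hβ : ColourRel n s} → u ≢ w →
  (∀ c → ¬ T ((h ⊕ hα ⊕ hβ) c u w)) → (∀ c → ¬ T ((h ⊕ hα ⊕ hβ) c w u)) →
  Touches u hα → Touches w hβ → Valid k (h ⊕ hα) → Valid k (h ⊕ hβ) → Valid k (h ⊕ hα ⊕ hβ)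
Valid-⊕-split {u = u} {w} {h} {hα} {hβ} u≢w uw-free wu-free at-u at-w validα validβ c (S , size≡ , clique)
  with T? (lookup S w) | T? (lookup S u)
... | no w∉S | _ = validα c (S , size≡ , λ i j i<j Si Sj → drop-β (clique i j i<j Si Sj) Si Sj)
  where
  drop-β : ∀ {i j} → T ((h ⊕ hα ⊕ hβ) c i j) → T (lookup S i) → T (lookup S j) → T ((h ⊕ hα) c i j)
  drop-β {i} {j} t Si Sj with Equivalence.to (T-∨ {h c i j}) t
  ... | inj₁ t′ = Equivalence.from T-∨ (inj₁ t′)
  ... | inj₂ t′ with Equivalence.to (T-∨ {hα c i j}) t′
  ...   | inj₁ tα = Equivalence.from (T-∨ {h c i j}) (inj₂ tα)
  ...   | inj₂ tβ with at-w c i j tβ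
  ...     | inj₁ refl = ⊥-elim (w∉S Si)
  ...     | inj₂ refl = ⊥-elim (w∉S Sj)
... | yes _ | no u∉S = validβ c (S , size≡ , λ i j i<j Si Sj → drop-α (clique i j i<j Si Sj) Si Sj)
  where
  drop-α : ∀ {i j} → T ((h ⊕ hα ⊕ hβ) c i j) → T (lookup S i) → T (lookup S j) → T ((h ⊕ hβ) c i j)
  drop-α {i} {j} t Si Sj with Equivalence.to (T-∨ {h c i j}) t
  ... | inj₁ t′ = Equivalence.from T-∨ (inj₁ t′)
  ... | inj₂ t′ with Equivalence.to (T-∨ {hα c i j}) t′
  ...   | inj₂ tβ = Equivalence.from (T-∨ {h c i j}) (inj₂ tβ)
  ...   | inj₁ tα with at-u c i j tα
  ...     | inj₁ refl = ⊥-elim (u∉S Si)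
  ...     | inj₂ refl = ⊥-elim (u∉S Sj)
... | yes w∈S | yes u∈S with <-cmp (toℕ u) (toℕ w)
...   | tri< u<w _ _ = uw-free c (clique u w u<w u∈S w∈S)
...   | tri≈ _ u≡w _ = u≢w (toℕ-injective u≡w)
...   | tri> _ _ w<u = wu-free c (clique w u w<u w∈S u∈S)

touches⁺ : {v i j : Fin n} → i ≡ v ⊎ j ≡ v → T (touches v (i , j))
touches⁺ {v = v} {j = j} (inj₁ refl) = Equivalence.from (T-∨ {v == v} {j == v}) (inj₁ (==-refl v))
touches⁺ {v = v} {i = i} (inj₂ refl) = Equivalence.from (T-∨ {i == v} {v == v}) (inj₂ (==-refl v))

¬touches⁺ : {v i j : Fin n} → i ≢ v → j ≢ v → T (not (touches v (i , j)))
¬touches⁺ i≢v j≢v = T-not⁺ λ t → [ i≢v , j≢v ]′ (touches⁻ t)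

validᵇ-⊕-split : {k : Vec ℕ s} {u w : Fin n} {h hα hβ : ColourRel n s} → u ≢ w →
  (∀ c → ¬ T ((h ⊕ hα ⊕ hβ) c u w)) → (∀ c → ¬ T ((h ⊕ hα ⊕ hβ) c w u)) → Touches u hα → Touches w hβ →
  validᵇ k (h ⊕ hα ⊕ hβ) ≡ validᵇ k (h ⊕ hα) ∧ validᵇ k (h ⊕ hβ)
validᵇ-⊕-split {k = k} {h = h} {hα} {hβ} u≢w uw-free wu-free at-u at-w = T-ext
  (λ t → Equivalence.from T-∧ (validᵇ-antitone {k = k} α⊆ t , validᵇ-antitone {k = k} β⊆ t))
  (λ t → let (tα , tβ) = Equivalence.to (T-∧ {validᵇ k (h ⊕ hα)}) t in validᵇ-complete {k = k}
     (Valid-⊕-split {k = k} u≢w uw-free wu-free at-u at-w (validᵇ-sound {k = k} tα) (validᵇ-sound {k = k} tβ)))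
  where
  α⊆ : ∀ c i j → toℕ i < toℕ j → T ((h ⊕ hα) c i j) → T ((h ⊕ hα ⊕ hβ) c i j)
  α⊆ c i j _ t with Equivalence.to (T-∨ {h c i j}) t
  ... | inj₁ t′ = Equivalence.from T-∨ (inj₁ t′)
  ... | inj₂ t′ = Equivalence.from (T-∨ {h c i j}) (inj₂ (Equivalence.from T-∨ (inj₁ t′)))
  β⊆ : ∀ c i j → toℕ i < toℕ j → T ((h ⊕ hβ) c i j) → T ((h ⊕ hα ⊕ hβ) c i j)
  β⊆ c i j _ t with Equivalence.to (T-∨ {h c i j}) t
  ... | inj₁ t′ = Equivalence.from T-∨ (inj₁ t′)
  ... | inj₂ t′ = Equivalence.from (T-∨ {h c i j}) (inj₂ (Equivalence.from (T-∨ {hα c i j}) (inj₂ t′)))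

edgesAt : Fin n → Graph n → List (Edge n)
edgesAt u G = edgesWhere G (touches u)

edgesAt∖ : Fin n → Fin n → Graph n → List (Edge n)
edgesAt∖ w u G = edgesWhere G (λ e → not (touches u e) ∧ touches w e)

edgesAvoiding : Fin n → Fin n → Graph n → List (Edge n)
edgesAvoiding u w G = edgesWhere G (λ e → not (touches u e) ∧ not (touches w e))

edges-↭ : (u w : Fin n) (G : Graph n) → edges G ↭ edgesAvoiding u w G ++ (edgesAt u G ++ edgesAt∖ w u G)
edges-↭ {n} u w G = begin
  edges G                                                                  ≡⟨ filterᵇ-cong (λ e → sym (∧-identityʳ (adjᵉ G e))) (pairs n) ⟩
  edgesWhere G (λ _ → true)                                                ↭⟨ edgesWhere-split G (λ _ → true) (touches u) ⟩
  edgesAt u G ++ edgesWhere G (λ e → not (touches u e))                    ↭⟨ Perm.++⁺ˡ (edgesAt u G) (edgesWhere-split G _ (touches w)) ⟩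
  edgesAt u G ++ (edgesAt∖ w u G ++ edgesAvoiding u w G)                   ≡⟨ ++-assoc (edgesAt u G) _ _ ⟨
  (edgesAt u G ++ edgesAt∖ w u G) ++ edgesAvoiding u w G                   ↭⟨ Perm.++-comm (edgesAt u G ++ edgesAt∖ w u G) _ ⟩
  edgesAvoiding u w G ++ (edgesAt u G ++ edgesAt∖ w u G)                   ∎
  where open PermutationReasoning

supported⁻ : {G : Graph n} {p : Edge n → Bool} {h : ColourRel n s} → Supported (edgesWhere G p) h →
  ∀ {c i j} → T (h c i j) → T (adj G i j) × T (p (i , j)) × toℕ i < toℕ j
supported⁻ {G = G} {p} supp {c} {i} {j} t = ∈-edgesWhere⁻ {G = G} {p} (supp c i j t)

extensions : Vec ℕ s → List (Edge n) → ColourRel n s → ℕ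
extensions k E h = ∑col E (λ h′ → validIndicator k (h ⊕ h′))

F-factorise : (k : Vec ℕ s) {G : Graph n} {u w : Fin n} → u ≢ w → adj G u w ≡ false →
  F G k ≡ ∑col (edgesAvoiding u w G) (λ h → extensions k (edgesAt u G) h * extensions k (edgesAt∖ w u G) h)
F-factorise k {G} {u} {w} u≢w u≁w = begin
  F G k
    ≡⟨ F≡∑col G k ⟩
  ∑col (edges G) χ
    ≡⟨ ∑col-↭ (edges-↭ u w G) (validIndicator-extensional k) ⟩
  ∑col (Av ++ (Eu ++ Ew)) χ
    ≡⟨ ∑col-++ Av (Eu ++ Ew) (validIndicator-extensional k) ⟩
  ∑col Av (λ h → ∑col (Eu ++ Ew) (λ h′ → χ (h ⊕ h′)))
    ≡⟨ ∑col-cong Av (λ h → ∑col-++ Eu Ew (Extensional-⊕ˡ h (validIndicator-extensional k))) ⟩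
  ∑col Av (λ h → ∑col Eu (λ hα → ∑col Ew (λ hβ → χ (h ⊕ hα ⊕ hβ))))
    ≡⟨ ∑col-cong-supported Av (λ h sh → ∑col-cong-supported Eu λ hα sα → ∑col-cong-supported Ew λ hβ sβ →
         trans (cong indicator (split sh sα sβ)) (indicator-∧ (validᵇ k (h ⊕ hα)) _)) ⟩
  ∑col Av (λ h → ∑col Eu (λ hα → ∑col Ew (λ hβ → χ (h ⊕ hα) * χ (h ⊕ hβ))))
    ≡⟨ ∑col-cong Av (λ h → ∑col-cong Eu λ hα → ∑col-*ˡ Ew (χ (h ⊕ hα)) _) ⟩
  ∑col Av (λ h → ∑col Eu (λ hα → χ (h ⊕ hα) * extensions k Ew h))
    ≡⟨ ∑col-cong Av (λ h → ∑col-*ʳ Eu (extensions k Ew h) _) ⟩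
  ∑col Av (λ h → extensions k Eu h * extensions k Ew h) ∎
  where
  open ≡-Reasoning
  χ : ColourRel _ _ → ℕ
  χ = validIndicator k
  Av Eu Ew : List (Edge _)
  Av = edgesAvoiding u w G
  Eu = edgesAt u G
  Ew = edgesAt∖ w u G
  split : ∀ {h hα hβ} → Supported Av h → Supported Eu hα → Supported Ew hβ →
    validᵇ k (h ⊕ hα ⊕ hβ) ≡ validᵇ k (h ⊕ hα) ∧ validᵇ k (h ⊕ hβ)
  split {h} {hα} {hβ} sh sα sβ = validᵇ-⊕-split {k = k} u≢w
    (λ c t → subst T u≁w (coloured-adjacent t))
    (λ c t → subst T (trans (Graph.sym G w u) u≁w) (coloured-adjacent t))
    (λ c i j t → touches⁻ (proj₁ (proj₂ (supported⁻ {G = G} sα t))))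
    (λ c i j t → touches⁻ (proj₂ (Equivalence.to T-∧ (proj₁ (proj₂ (supported⁻ {G = G} sβ t))))))
    where
    coloured-adjacent : ∀ {c i j} → T ((h ⊕ hα ⊕ hβ) c i j) → T (adj G i j)
    coloured-adjacent {c} {i} {j} t with Equivalence.to (T-∨ {h c i j}) t
    ... | inj₁ t′ = proj₁ (supported⁻ {G = G} sh t′)
    ... | inj₂ t′ with Equivalence.to (T-∨ {hα c i j}) t′
    ...   | inj₁ tα = proj₁ (supported⁻ {G = G} sα tα)
    ...   | inj₂ tβ = proj₁ (supported⁻ {G = G} sβ tβ)

neighbours : Graph n → Fin n → List (Fin n)
neighbours {n} G a = filterᵇ (adj G a) (allFin n)

adj⇒≢ : (G : Graph n) {a x : Fin n} → T (adj G a x) → a ≢ x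
adj⇒≢ G {a} t refl = subst T (Graph.irrefl G a) t

star-↭ : (G : Graph n) (a : Fin n) (p : Edge n → Bool) →
  (∀ {i j} → toℕ i < toℕ j → T (adj G i j) → T (p (i , j)) ⇔ (i ≡ a ⊎ j ≡ a)) →
  edgesWhere G p ↭ map (key a) (neighbours G a)
star-↭ {n} G a p at-a = ↭-unique
  (Unique.filter⁺ _ pairs-unique) (Unique.map⁺ key-injective (Unique.filter⁺ _ (Unique.allFin⁺ n))) to from
  where
  to : ∀ {e} → e ∈ edgesWhere G p → e ∈ map (key a) (neighbours G a)
  to {i , j} e∈ with ∈-edgesWhere⁻ {G = G} {p} e∈
  ... | adjG , pe , i<j with Equivalence.to (at-a i<j adjG) pe
  ... | inj₁ refl = subst (_∈ _) (key-unique i<j (inj₁ (refl , refl)))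
                      (∈-map⁺ (key a) (∈-filterᵇ⁺ (adj G a) (∈-allFin j) adjG))
  ... | inj₂ refl = subst (_∈ _) (key-unique i<j (inj₂ (refl , refl)))
                      (∈-map⁺ (key a) (∈-filterᵇ⁺ (adj G a) (∈-allFin i) (subst T (Graph.sym G i a) adjG)))
  from : ∀ {e} → e ∈ map (key a) (neighbours G a) → e ∈ edgesWhere G p
  from e∈ with ∈-map⁻ (key a) e∈
  ... | x , x∈ , refl with proj₂ (∈-filterᵇ⁻ {xs = allFin n} (adj G a) x∈)
  ... | ax with key-ordered (adj⇒≢ G ax) | key-cases a x
  ...   | ordered | inj₁ (eq , _) rewrite eq = ∈-filterᵇ⁺ (λ e → adjᵉ G e ∧ p e) (∈-pairs⁺ ordered)
          (Equivalence.from T-∧ (xa , Equivalence.from (at-a ordered xa) (inj₂ refl)))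
    where
    xa : T (adj G x a)
    xa = subst T (Graph.sym G a x) ax
  ...   | ordered | inj₂ (eq , _) rewrite eq = ∈-filterᵇ⁺ (λ e → adjᵉ G e ∧ p e) (∈-pairs⁺ ordered)
          (Equivalence.from T-∧ (ax , Equivalence.from (at-a ordered ax) (inj₁ refl)))

redirect : Fin n → Fin n → Fin n → Fin n
redirect a b x with x ≟ b
... | yes _ = a
... | no  _ = x

redirect-source : (a b : Fin n) → redirect a b b ≡ a
redirect-source a b with b ≟ b
... | yes _   = refl
... | no  b≢b = ⊥-elim (b≢b refl)

redirect-other : (a b : Fin n) {x : Fin n} → x ≢ b → redirect a b x ≡ x
redirect-other a b {x} x≢b with x ≟ b
... | yes x≡b = ⊥-elim (x≢b x≡b)
... | no  _   = refl

-- b becomes a twin of a: a non-adjacent vertex with the neighbourhood of a.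
clone : Graph n → Fin n → Fin n → Graph n
clone G a b = record
  { adj    = λ i j → adj G (redirect a b i) (redirect a b j)
  ; sym    = λ i j → Graph.sym G (redirect a b i) (redirect a b j)
  ; irrefl = λ i → Graph.irrefl G (redirect a b i)
  }

clone-adj-away : (G : Graph n) (a b : Fin n) {i j : Fin n} → i ≢ b → j ≢ b → adj (clone G a b) i j ≡ adj G i j
clone-adj-away G a b i≢b j≢b = cong₂ (adj G) (redirect-other a b i≢b) (redirect-other a b j≢b)

adj-redirect : (G : Graph n) {a b : Fin n} → adj G a b ≡ false → (x : Fin n) → adj G a (redirect a b x) ≡ adj G a x
adj-redirect G {a} {b} a≁b x with x ≟ b
... | yes refl = trans (Graph.irrefl G a) (sym a≁b)
... | no  _    = refl

clone-adj-twin : (G : Graph n) {a b : Fin n} → adj G a b ≡ false → (x : Fin n) → adj (clone G a b) b x ≡ adj G a x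
clone-adj-twin G {a} {b} a≁b x = trans (cong (λ y → adj G y (redirect a b x)) (redirect-source a b)) (adj-redirect G a≁b x)

clone-adj-original : (G : Graph n) {a b : Fin n} → a ≢ b → adj G a b ≡ false → (x : Fin n) →
  adj (clone G a b) a x ≡ adj G a x
clone-adj-original G {a} {b} a≢b a≁b x =
  trans (cong (λ y → adj G y (redirect a b x)) (redirect-other a b a≢b)) (adj-redirect G a≁b x)

edgesAt-↭ : (G : Graph n) (u : Fin n) → edgesAt u G ↭ map (key u) (neighbours G u)
edgesAt-↭ G u = star-↭ G u (touches u) (λ _ _ → mk⇔ touches⁻ touches⁺)

non-neighbour : (G : Graph n) {a x y : Fin n} → T (adj G a x) → adj G a y ≡ false → x ≢ y
non-neighbour G ax ay≡false refl = subst T ay≡false ax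

edgesAt∖-↭ : (G : Graph n) {u w : Fin n} → u ≢ w → adj G u w ≡ false →
  edgesAt∖ w u G ↭ map (key w) (neighbours G w)
edgesAt∖-↭ G {u} {w} u≢w u≁w = star-↭ G w _ λ {i} {j} _ adjG →
  mk⇔ (λ t → touches⁻ (proj₂ (Equivalence.to (T-∧ {not (touches u (i , j))}) t))) (from adjG)
  where
  w≁u : adj G w u ≡ false
  w≁u = trans (Graph.sym G w u) u≁w
  from : ∀ {i j} → T (adj G i j) → i ≡ w ⊎ j ≡ w → T (not (touches u (i , j)) ∧ touches w (i , j))
  from {j = j} adjG (inj₁ refl) = Equivalence.from T-∧
    (¬touches⁺ (λ w≡u → u≢w (sym w≡u)) (non-neighbour G adjG w≁u) , touches⁺ {v = w} {j = j} (inj₁ refl))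
  from {i} adjG (inj₂ refl) = Equivalence.from T-∧
    (¬touches⁺ (non-neighbour G (subst T (Graph.sym G i w) adjG) w≁u) (λ w≡u → u≢w (sym w≡u)) , touches⁺ {v = w} {i = i} (inj₂ refl))

module _ (k : Vec ℕ s) {G : Graph n} {u w : Fin n} (u≢w : u ≢ w) (u≁w : adj G u w ≡ false) where

  private
    G₁ G₂ : Graph n
    G₁ = clone G u w
    G₂ = clone G w u

    Av : List (Edge n)
    Av = edgesAvoiding u w G

    w≢u : w ≢ u
    w≢u w≡u = u≢w (sym w≡u)

    w≁u : adj G w u ≡ false
    w≁u = trans (Graph.sym G w u) u≁w

    a b : ColourRel n s → ℕ
    a = extensions k (edgesAt u G)
    b = extensions k (edgesAt∖ w u G)

    ext : (h : ColourRel n s) → Extensional (λ h′ → validIndicator k (h ⊕ h′))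
    ext h = Extensional-⊕ˡ h (validIndicator-extensional k)

    Av-upper : {h : ColourRel n s} → Supported Av h → Upper h
    Av-upper sh c i j t = proj₂ (proj₂ (supported⁻ {G = G} sh t))

    Av-avoids : {h : ColourRel n s} → Supported Av h → ∀ c i j → T (h c i j) → Avoids u w i × Avoids u w j
    Av-avoids sh c i j t with Equivalence.to (T-∧ {not (touches u (i , j))}) (proj₁ (proj₂ (supported⁻ {G = G} sh t)))
    ... | ¬tu , ¬tw with ¬touches⁻ {v = u} {i} {j} ¬tu | ¬touches⁻ {v = w} {i} {j} ¬tw
    ... | i≢u , j≢u | i≢w , j≢w = (i≢u , i≢w) , (j≢u , j≢w)

    neighbours-u-avoid : ∀ {x} → x ∈ neighbours G u → Avoids u w x
    neighbours-u-avoid x∈ with ∈-filterᵇ⁻ {xs = allFin n} (adj G u) x∈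
    ... | _ , ux = (λ x≡u → adj⇒≢ G ux (sym x≡u)) , non-neighbour G ux u≁w

    neighbours-w-avoid : ∀ {x} → x ∈ neighbours G w → Avoids u w x
    neighbours-w-avoid x∈ with ∈-filterᵇ⁻ {xs = allFin n} (adj G w) x∈
    ... | _ , wx = non-neighbour G wx w≁u , (λ x≡w → adj⇒≢ G wx (sym x≡w))

    u≁w₁ : adj G₁ u w ≡ false
    u≁w₁ = trans (clone-adj-original G u≢w u≁w w) u≁w

    u≁w₂ : adj G₂ u w ≡ false
    u≁w₂ = trans (Graph.sym G₂ u w) (trans (clone-adj-original G w≢u w≁u u) w≁u)

    twin-star₁ : {h : ColourRel n s} → Supported Av h → a h ≡ extensions k (edgesAt∖ w u G₁) h
    twin-star₁ {h} sh = begin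
      a h
        ≡⟨ ∑col-↭ (edgesAt-↭ G u) (ext h) ⟩
      ∑col (map (key u) (neighbours G u)) χ⊕
        ≡⟨ star-transpose k (neighbours G u) neighbours-u-avoid (Av-upper sh)
             (relabel-transpose-avoiding (Av-upper sh) (Av-avoids sh)) ⟩
      ∑col (map (key w) (neighbours G u)) χ⊕
        ≡⟨ cong (λ N → ∑col (map (key w) N) χ⊕) (filterᵇ-cong (clone-adj-twin G u≁w) (allFin n)) ⟨
      ∑col (map (key w) (neighbours G₁ w)) χ⊕
        ≡⟨ ∑col-↭ (edgesAt∖-↭ G₁ u≢w u≁w₁) (ext h) ⟨
      extensions k (edgesAt∖ w u G₁) h ∎
      where
      open ≡-Reasoning
      χ⊕ : ColourRel n s → ℕ
      χ⊕ h′ = validIndicator k (h ⊕ h′)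

    twin-star₂ : {h : ColourRel n s} → Supported Av h → extensions k (edgesAt u G₂) h ≡ b h
    twin-star₂ {h} sh = begin
      extensions k (edgesAt u G₂) h
        ≡⟨ ∑col-↭ (edgesAt-↭ G₂ u) (ext h) ⟩
      ∑col (map (key u) (neighbours G₂ u)) χ⊕
        ≡⟨ cong (λ N → ∑col (map (key u) N) χ⊕) (filterᵇ-cong (clone-adj-twin G w≁u) (allFin n)) ⟩
      ∑col (map (key u) (neighbours G w)) χ⊕
        ≡⟨ star-transpose k (neighbours G w) neighbours-w-avoid (Av-upper sh)
             (relabel-transpose-avoiding (Av-upper sh) (Av-avoids sh)) ⟩
      ∑col (map (key w) (neighbours G w)) χ⊕
        ≡⟨ ∑col-↭ (edgesAt∖-↭ G u≢w u≁w) (ext h) ⟨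
      b h ∎
      where
      open ≡-Reasoning
      χ⊕ : ColourRel n s → ℕ
      χ⊕ h′ = validIndicator k (h ⊕ h′)

    edgesAt₁ : edgesAt u G₁ ≡ edgesAt u G
    edgesAt₁ = edgesWhere-cong {G = G₁} {G} (touches u) agree
      where
      agree : ∀ e → T (touches u e) → adjᵉ G₁ e ≡ adjᵉ G e
      agree (i , j) t with touches⁻ {v = u} {i} {j} t
      ... | inj₁ refl = clone-adj-original G u≢w u≁w j
      ... | inj₂ refl = trans (Graph.sym G₁ i u) (trans (clone-adj-original G u≢w u≁w i) (Graph.sym G u i))

    edgesAvoiding₁ : edgesAvoiding u w G₁ ≡ Av
    edgesAvoiding₁ = edgesWhere-cong {G = G₁} {G} _ λ (i , j) t →
      let i≢w , j≢w = ¬touches⁻ {v = w} {i} {j} (proj₂ (∧-T {not (touches u (i , j))} t))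
      in  clone-adj-away G u w i≢w j≢w

    edgesAvoiding₂ : edgesAvoiding u w G₂ ≡ Av
    edgesAvoiding₂ = edgesWhere-cong {G = G₂} {G} _ λ (i , j) t →
      let i≢u , j≢u = ¬touches⁻ {v = u} {i} {j} (proj₁ (∧-T {not (touches u (i , j))} t))
      in  clone-adj-away G w u i≢u j≢u

    edgesAt∖₂ : edgesAt∖ w u G₂ ≡ edgesAt∖ w u G
    edgesAt∖₂ = edgesWhere-cong {G = G₂} {G} _ λ (i , j) t →
      let i≢u , j≢u = ¬touches⁻ {v = u} {i} {j} (proj₁ (∧-T {not (touches u (i , j))} t))
      in  clone-adj-away G w u i≢u j≢u

  F-clone₁ : F (clone G u w) k ≡ ∑col Av (λ h → a h * a h)
  F-clone₁ = begin
    F G₁ k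
      ≡⟨ F-factorise k {G₁} u≢w u≁w₁ ⟩
    ∑col (edgesAvoiding u w G₁) (λ h → extensions k (edgesAt u G₁) h * extensions k (edgesAt∖ w u G₁) h)
      ≡⟨ cong₂ (λ A E → ∑col A (λ h → extensions k E h * extensions k (edgesAt∖ w u G₁) h)) edgesAvoiding₁ edgesAt₁ ⟩
    ∑col Av (λ h → a h * extensions k (edgesAt∖ w u G₁) h)
      ≡⟨ ∑col-cong-supported Av (λ h sh → cong (a h *_) (twin-star₁ sh)) ⟨
    ∑col Av (λ h → a h * a h) ∎
    where open ≡-Reasoning

  F-clone₂ : F (clone G w u) k ≡ ∑col Av (λ h → b h * b h)
  F-clone₂ = begin
    F G₂ k
      ≡⟨ F-factorise k {G₂} u≢w u≁w₂ ⟩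
    ∑col (edgesAvoiding u w G₂) (λ h → extensions k (edgesAt u G₂) h * extensions k (edgesAt∖ w u G₂) h)
      ≡⟨ cong₂ (λ A E → ∑col A (λ h → extensions k (edgesAt u G₂) h * extensions k E h)) edgesAvoiding₂ edgesAt∖₂ ⟩
    ∑col Av (λ h → extensions k (edgesAt u G₂) h * b h)
      ≡⟨ ∑col-cong-supported Av (λ h sh → cong (_* b h) (twin-star₂ sh)) ⟩
    ∑col Av (λ h → b h * b h) ∎
    where open ≡-Reasoning

  2F≤F-twins : 2 * F G k ≤ F (clone G u w) k + F (clone G w u) k
  2F≤F-twins = begin
    2 * F G k                                             ≡⟨ cong (2 *_) (F-factorise k {G} u≢w u≁w) ⟩
    2 * ∑col Av (λ h → a h * b h)                         ≡⟨ ∑col-*ˡ Av 2 _ ⟨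
    ∑col Av (λ h → 2 * (a h * b h))                       ≤⟨ ∑col-mono Av (λ h → 2*m*n≤m*m+n*n (a h) (b h)) ⟩
    ∑col Av (λ h → a h * a h + b h * b h)                 ≡⟨ ∑col-+ Av _ _ ⟩
    ∑col Av (λ h → a h * a h) + ∑col Av (λ h → b h * b h) ≡⟨ cong₂ _+_ F-clone₁ F-clone₂ ⟨
    F G₁ k + F G₂ k                                       ∎
    where open ≤-Reasoning

-- Extremal graphs and symmetrisation

Extremal : Vec ℕ s → Graph n → Set
Extremal {n = n} k G = (H : Graph n) → F H k ≤ F G k

Extremal-cong : {k : Vec ℕ s} {G H : Graph n} → Extremal k G → (∀ i j → adj G i j ≡ adj H i j) →
  Extremal k H
Extremal-cong {k = k} {G} {H} extremal adj≡ H′ = ≤-trans (extremal H′) (≤-reflexive (F-cong {G = G} {H} k adj≡))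

redirect-self : (a x : Fin n) → redirect a a x ≡ x
redirect-self a x with x ≟ a
... | yes x≡a = sym x≡a
... | no  _   = refl

half-≤ : ∀ {a b c} → 2 * a ≤ b + c → c ≤ a → a ≤ b
half-≤ {a} {b} {c} 2a≤b+c c≤a = +-cancelʳ-≤ a a b (begin
  a + a      ≡⟨ cong (a +_) (+-identityʳ a) ⟨
  2 * a      ≤⟨ 2a≤b+c ⟩
  b + c      ≤⟨ +-monoʳ-≤ b c≤a ⟩
  b + a      ∎)
  where open ≤-Reasoning

clone-extremal : (k : Vec ℕ s) {G : Graph n} {u w : Fin n} → Extremal k G → adj G u w ≡ false →
  Extremal k (clone G u w)
clone-extremal k {G} {u} {w} extremal u≁w with u ≟ w
... | yes refl = Extremal-cong {k = k} {G = G} {clone G u u} extremal λ i j →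
  sym (cong₂ (adj G) (redirect-self u i) (redirect-self u j))
... | no  u≢w  = λ H → ≤-trans (extremal H) (half-≤ (2F≤F-twins k {G = G} u≢w u≁w) (extremal (clone G w u)))

redirect-target : (a b : Fin n) → redirect a b a ≡ a
redirect-target a b with a ≟ b
... | yes _ = refl
... | no  _ = refl

redirect-cases : (a b x : Fin n) → redirect a b x ≡ x ⊎ redirect a b x ≡ a
redirect-cases a b x with x ≟ b
... | yes _ = inj₂ refl
... | no  _ = inj₁ refl

twinsOf : Graph n → Fin n → List (Fin n) → Graph n
twinsOf G x []       = G
twinsOf G x (v ∷ vs) = clone (twinsOf G x vs) x v

redirectAll : Fin n → List (Fin n) → Fin n → Fin n
redirectAll x []       a = a
redirectAll x (v ∷ vs) a = redirectAll x vs (redirect x v a)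

adj-twinsOf : (G : Graph n) (x : Fin n) (vs : List (Fin n)) (a b : Fin n) →
  adj (twinsOf G x vs) a b ≡ adj G (redirectAll x vs a) (redirectAll x vs b)
adj-twinsOf G x []       a b = refl
adj-twinsOf G x (v ∷ vs) a b = adj-twinsOf G x vs (redirect x v a) (redirect x v b)

redirectAll-target : (x : Fin n) (vs : List (Fin n)) → redirectAll x vs x ≡ x
redirectAll-target x []       = refl
redirectAll-target x (v ∷ vs) = trans (cong (redirectAll x vs) (redirect-target x v)) (redirectAll-target x vs)

redirectAll-cases : (x : Fin n) (vs : List (Fin n)) (a : Fin n) → redirectAll x vs a ≡ a ⊎ redirectAll x vs a ≡ x
redirectAll-cases x []       a = inj₁ refl
redirectAll-cases x (v ∷ vs) a with redirect-cases x v a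
... | inj₁ eq rewrite eq = redirectAll-cases x vs a
... | inj₂ eq rewrite eq = inj₂ (redirectAll-target x vs)

redirectAll-∈ : (x : Fin n) (vs : List (Fin n)) {a : Fin n} → a ∈ vs → redirectAll x vs a ≡ x
redirectAll-∈ x (v ∷ vs) (here refl) rewrite redirect-source x v = redirectAll-target x vs
redirectAll-∈ x (v ∷ vs) {a} (there a∈) with redirect-cases x v a
... | inj₁ eq rewrite eq = redirectAll-∈ x vs a∈
... | inj₂ eq rewrite eq = redirectAll-target x vs

redirectAll-∉ : (x : Fin n) (vs : List (Fin n)) {a : Fin n} → a ∉ vs → redirectAll x vs a ≡ a
redirectAll-∉ x []       a∉ = refl
redirectAll-∉ x (v ∷ vs) {a} a∉ rewrite redirect-other x v (a∉ ∘ here) = redirectAll-∉ x vs (a∉ ∘ there)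

twinsOf-extremal : (k : Vec ℕ s) {G : Graph n} {x : Fin n} (vs : List (Fin n)) → Extremal k G →
  (∀ {v} → v ∈ vs → adj G x v ≡ false) → Extremal k (twinsOf G x vs)
twinsOf-extremal k []       extremal _ = extremal
twinsOf-extremal k {G} {x} (v ∷ vs) extremal x≁vs =
  clone-extremal k {twinsOf G x vs} (twinsOf-extremal k vs extremal (x≁vs ∘ there)) x≁v
  where
  x≁v : adj (twinsOf G x vs) x v ≡ false
  x≁v rewrite adj-twinsOf G x vs x v | redirectAll-target x vs with redirectAll-cases x vs v
  ... | inj₁ eq rewrite eq = x≁vs (here refl)
  ... | inj₂ eq rewrite eq = Graph.irrefl G x

nonNeighbours : Graph n → Fin n → List (Fin n)
nonNeighbours {n} G x = filterᵇ (not ∘ adj G x) (allFin n)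

absorb : Graph n → Fin n → Graph n
absorb G x = twinsOf G x (nonNeighbours G x)

absorb-extremal : (k : Vec ℕ s) {G : Graph n} (x : Fin n) → Extremal k G → Extremal k (absorb G x)
absorb-extremal {n = n} k {G} x extremal = twinsOf-extremal k (nonNeighbours G x) extremal λ v∈ →
  Equivalence.to T-not-≡ (proj₂ (∈-filterᵇ⁻ {xs = allFin n} (not ∘ adj G x) v∈))

absorb-representative : (G : Graph n) (x a : Fin n) →
  (adj G x a ≡ true × redirectAll x (nonNeighbours G x) a ≡ a) ⊎ (adj G x a ≡ false × redirectAll x (nonNeighbours G x) a ≡ x)
absorb-representative {n} G x a with adj G x a in xa
... | true  = inj₁ (refl , redirectAll-∉ x _ λ a∈ → subst (T ∘ not) xa (proj₂ (∈-filterᵇ⁻ {xs = allFin n} (not ∘ adj G x) a∈)))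
... | false = inj₂ (refl , redirectAll-∈ x _ (∈-filterᵇ⁺ (not ∘ adj G x) (∈-allFin a) (subst (T ∘ not) (sym xa) _)))

TwinClosed : Graph n → Fin n → Set
TwinClosed G a = ∀ b → adj G a b ≡ false → ∀ z → adj G a z ≡ adj G b z

absorb-twinClosed : (G : Graph n) (x a : Fin n) → (adj G x a ≡ true → TwinClosed G a) → TwinClosed (absorb G x) a
absorb-twinClosed {n} G x a closed b a≁b z =
  trans (adj-twinsOf G x vs a z) (trans (same (trans (sym (adj-twinsOf G x vs a b)) a≁b)) (sym (adj-twinsOf G x vs b z)))
  where
  vs : List (Fin n)
  vs = nonNeighbours G x
  ρ : Fin n → Fin n
  ρ = redirectAll x vs
  same : adj G (ρ a) (ρ b) ≡ false → adj G (ρ a) (ρ z) ≡ adj G (ρ b) (ρ z)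
  same ρa≁ρb with absorb-representative G x a | absorb-representative G x b
  ... | inj₁ (xa , ρa) | _ = trans (cong (λ y → adj G y (ρ z)) ρa)
                                   (closed xa (ρ b) (subst (λ y → adj G y (ρ b) ≡ false) ρa ρa≁ρb) (ρ z))
  ... | inj₂ (_ , ρa) | inj₁ (xb , ρb) = ⊥-elim (true≢false (trans (sym xb) (trans (cong₂ (adj G) (sym ρa) (sym ρb)) ρa≁ρb)))
  ... | inj₂ (_ , ρa) | inj₂ (_ , ρb) = cong (λ y → adj G y (ρ z)) (trans ρa (sym ρb))

TwinClosedBelow : Graph n → ℕ → Set
TwinClosedBelow G t = ∀ a → toℕ a < t → TwinClosed G a

absorb-step : {G : Graph n} {t : ℕ} → TwinClosedBelow G t → (x : Fin n) → toℕ x ≡ t →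
  TwinClosedBelow (absorb G x) (suc t)
absorb-step {G = G} closed x refl a a<1+x with m≤n⇒m<n∨m≡n (s≤s⁻¹ a<1+x)
... | inj₁ a<x = absorb-twinClosed G x a (λ _ → closed a a<x)
... | inj₂ a≡x with toℕ-injective a≡x
... | refl = absorb-twinClosed G x x (λ x∼x → ⊥-elim (true≢false (trans (sym x∼x) (Graph.irrefl G x))))

symmetrise : (k : Vec ℕ s) {G₀ : Graph n} (t : ℕ) → t ≤ n → Extremal k G₀ →
  Σ (Graph n) λ G → Extremal k G × TwinClosedBelow G t
symmetrise k {G₀} zero    _   extremal = G₀ , extremal , λ a ()
symmetrise {n = n} k {G₀} (suc t) t<n extremal with symmetrise k {G₀} t (<⇒≤ t<n) extremal
... | G , extremalG , closed = absorb G next , absorb-extremal k next extremalG , absorb-step closed next (toℕ-fromℕ< t<n)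
  where
  next : Fin n
  next = fromℕ< t<n

-- Complete multipartite graphs

firstFalse : (Fin m → Bool) → Maybe (Fin m)
firstFalse {zero}  f = nothing
firstFalse {suc m} f = if f Fin.zero then Maybe.map Fin.suc (firstFalse (λ i → f (Fin.suc i))) else just Fin.zero

firstFalse-cong : {f g : Fin m → Bool} → (∀ i → f i ≡ g i) → firstFalse f ≡ firstFalse g
firstFalse-cong {zero}  f≗g = refl
firstFalse-cong {suc m} {f} {g} f≗g
  rewrite f≗g Fin.zero | firstFalse-cong {m} {λ i → f (Fin.suc i)} {λ i → g (Fin.suc i)} (f≗g ∘ Fin.suc) = refl

firstFalse-complete : (f : Fin m → Bool) {z : Fin m} → f z ≡ false →
  Σ (Fin m) λ y → firstFalse f ≡ just y × f y ≡ false
firstFalse-complete {suc m} f {z} fz with f Fin.zero in f0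
... | false = Fin.zero , refl , f0
... | true with z
...   | Fin.zero  = ⊥-elim (true≢false (trans (sym f0) fz))
...   | Fin.suc z′ with firstFalse-complete (λ i → f (Fin.suc i)) fz
...     | y , eq , fy = Fin.suc y , cong (Maybe.map Fin.suc) eq , fy

twinClosed⇒completeMultipartite : (G : Graph n) → (∀ a → TwinClosed G a) → IsCompleteMultipartite G
twinClosed⇒completeMultipartite {n} G closed = n , part , λ i j → mk⇔ (separated i j) (adjacent i j)
  where
  part : Fin n → Fin n
  part i = fromMaybe i (firstFalse (adj G i))
  part-spec : ∀ i → Σ (Fin n) λ y → firstFalse (adj G i) ≡ just y × part i ≡ y × adj G i y ≡ false
  part-spec i with firstFalse-complete (adj G i) (Graph.irrefl G i)
  ... | y , eq , iy = y , eq , cong (fromMaybe i) eq , iy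
  separated : ∀ i j → adj G i j ≡ true → part i ≢ part j
  separated i j ij part≡ with part-spec i | part-spec j
  ... | y , _ , refl , iy | y′ , _ , py , jy = true≢false (begin
    true        ≡⟨ ij ⟨
    adj G i j   ≡⟨ closed i y iy j ⟩
    adj G y j   ≡⟨ Graph.sym G y j ⟩
    adj G j y   ≡⟨ cong (adj G j) (trans part≡ py) ⟩
    adj G j y′  ≡⟨ jy ⟩
    false       ∎)
    where
    open ≡-Reasoning
  adjacent : ∀ i j → part i ≢ part j → adj G i j ≡ true
  adjacent i j part≢ with adj G i j in ij
  ... | true  = refl
  ... | false with part-spec i | part-spec j
  ...   | _ , eqi , pi , _ | _ , eqj , pj , _ =
    ⊥-elim (part≢ (trans pi (trans (just-injective (trans (sym eqi) (trans (firstFalse-cong (closed i j ij)) eqj))) (sym pj))))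


<ᵇ-irrefl : ∀ m → (m <ᵇ m) ≡ false
<ᵇ-irrefl zero    = refl
<ᵇ-irrefl (suc m) = <ᵇ-irrefl m

<ᵇ-asym : ∀ {m n} → m < n → (n <ᵇ m) ≡ false
<ᵇ-asym {m} {n} m<n = T-ext (λ n<ᵇm → <-asym m<n (<ᵇ⇒< n m n<ᵇm)) λ ()

-- Only the entries f i j with i < j are used.
fromAdjacency : (Fin n → Fin n → Bool) → Graph n
fromAdjacency f = record
  { adj    = λ i j → ((toℕ i <ᵇ toℕ j) ∧ f i j) ∨ ((toℕ j <ᵇ toℕ i) ∧ f j i)
  ; sym    = λ i j → ∨-comm ((toℕ i <ᵇ toℕ j) ∧ f i j) _
  ; irrefl = λ i → cong (λ b → (b ∧ f i i) ∨ (b ∧ f i i)) (<ᵇ-irrefl (toℕ i))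
  }

fromAdjacency-adj : (G : Graph n) {f : Fin n → Fin n → Bool} → (∀ i j → f i j ≡ adj G i j) →
  ∀ i j → adj (fromAdjacency f) i j ≡ adj G i j
fromAdjacency-adj G {f} f≗ i j with <-cmp (toℕ i) (toℕ j)
... | tri< i<j _ _ rewrite Equivalence.to T-≡ (<⇒<ᵇ i<j) | <ᵇ-asym i<j = trans (∨-identityʳ (f i j)) (f≗ i j)
... | tri≈ _ i≡j _ rewrite toℕ-injective i≡j | <ᵇ-irrefl (toℕ j) = sym (Graph.irrefl G j)
... | tri> _ _ j<i rewrite Equivalence.to T-≡ (<⇒<ᵇ j<i) | <ᵇ-asym j<i = trans (f≗ j i) (Graph.sym G j i)

adjacencyCodes : List (Vec (Vec Bool n) n)
adjacencyCodes {n} = allVecs (allVecs bools n) n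

decode : Vec (Vec Bool n) n → Fin n → Fin n → Bool
decode V i j = lookup (lookup V i) j

encode : (Fin n → Fin n → Bool) → Vec (Vec Bool n) n
encode f = tabulate (λ i → tabulate (f i))

decode-encode : (f : Fin n → Fin n → Bool) → ∀ i j → decode (encode f) i j ≡ f i j
decode-encode f i j rewrite lookup∘tabulate (λ i → tabulate (f i)) i = lookup∘tabulate (f i) j

encode∈adjacencyCodes : (f : Fin n → Fin n → Bool) → encode f ∈ adjacencyCodes
encode∈adjacencyCodes {n} f = ∈-allVecs (allVecs bools n) (encode f) λ i →
  subst (_∈ allVecs bools n) (sym (lookup∘tabulate (λ i → tabulate (f i)) i)) (∈-allVecs bools (tabulate (f i)) λ j → ∈-bools _)

extremal-exists : (k : Vec ℕ s) → Σ (Graph n) (Extremal k)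
extremal-exists {n = n} k = fromAdjacency (decode best) , λ H → begin
  F H k                                                ≡⟨ F-cong {G = H} {fromAdjacency (decode (encode (adj H)))} k
                                                            (λ i j → sym (fromAdjacency-adj H (decode-encode (adj H)) i j)) ⟩
  score (encode (adj H))                               ≤⟨ v≤f[argmax]⁺ {f = score} _ adjacencyCodes (inj₂ (lose (encode∈adjacencyCodes (adj H)) ≤-refl)) ⟩
  score best                                           ∎
  where
  open ≤-Reasoning
  score : Vec (Vec Bool n) n → ℕ
  score V = F (fromAdjacency (decode V)) k
  best : Vec (Vec Bool n) n
  best = argmax score (encode (λ _ _ → false)) adjacencyCodes

theorem2 : (n s : ℕ) (k : Vec ℕ s) →
    Σ (Graph n) λ G → IsCompleteMultipartite G × ((H : Graph n) → F H k ≤ F G k)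
theorem2 n s k =
  let G₀ , extremal₀ = extremal-exists k
      G , extremal , closed = symmetrise k {G₀} n ≤-refl extremal₀
  in  G , twinClosed⇒completeMultipartite G (λ a → closed a (toℕ<n a)) , extremal
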